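{- Let $q$ be any prime power and let $f\in\mathbb F_q(X)$ have degree $3$. Then $f$ is in Class II if and only if $f$ has a ramification point of type $2/1$, i.e. there is $a\in\mathbb P^1(\mathbb F_q)$ with $e_f(a)=2$.
   Context: $\mathbb F_q$ is the field with $q$ elements; $\deg(g/h)=\max\{\deg g,\deg h\}$ for coprime $g,h$. A rational function induces a map $\mathbb P^1(\mathbb F_q)=\mathbb F_q\cup\{\infty\}\to\mathbb P^1(\mathbb F_q)$; $f^{ -1}(\alpha)$ is the preimage in $\mathbb P^1(\mathbb F_q)$. A degree-3 $f$ is in Class II if $|f^{ -1}(\alpha)|=2$ for some $\alpha\in\mathbb P^1(\mathbb F_q)$. For $a\in\mathbb P^1(\mathbb F_q)$ the ramification index $e_f(a)$ is: $\nu_{X-a}(f(X)-f(a))$ if $a\neq\infty$, $f(a)\neq\infty$; $\nu_{X-a}(1/f(X))$ if $a\neq\infty$, $f(a)=\infty$; $\nu_X(f(1/X)-f(\infty))$ if $a=\infty$, $f(\infty)\neq\infty$; $\nu_X(1/f(1/X))$ if $a=\infty=f(\infty)$. Here $\nu_{X-a}$ denotes the order of vanishing at $X=a$ (the exponent of $X-a$ in the rational function). A ramification point of type $2/1$ is a point $a\in\mathbb P^1(\mathbb F_q)$ with $e_f(a)=2$. -}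

module Defs where

open import Level using (Level; suc; _⊔_)
open import Data.Nat as ℕ using (ℕ; zero; _∸_; _<_)
open import Data.Fin using (Fin)
open import Data.List using (List; []; _∷_; map; upTo)
open import Data.Maybe using (Maybe; just; nothing)
open import Data.Bool using (Bool; true; false; if_then_else_)
open import Data.Product using (Σ; ∃; ∃-syntax; _×_; _,_)
open import Data.Sum using (_⊎_)
open import Relation.Nullary using (¬_; Dec; yes; no; does)
open import Relation.Binary.PropositionalEquality using (_≡_; _≢_)
open import Function.Bundles using (_↔_)

-- A finite field F_q : a field (with propositional equality and
-- decidable equality) whose carrier is in bijection with Fin q.
-- (Every finite field has prime-power order and every prime power
-- occurs, so quantifying over finite fields = quantifying over F_q.)

record FiniteField (c : Level) : Set (suc c) where
  infixl 6 _+_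
  infixl 7 _*_
  field
    Carrier : Set c
    0# 1#   : Carrier
    _+_ _*_ : Carrier → Carrier → Carrier
    -_      : Carrier → Carrier
    _⁻¹     : Carrier → Carrier
    _≟_     : (x y : Carrier) → Dec (x ≡ y)
    +-assoc  : ∀ x y z → (x + y) + z ≡ x + (y + z)
    +-comm   : ∀ x y → x + y ≡ y + x
    +-identityˡ : ∀ x → 0# + x ≡ x
    -‿inverseˡ : ∀ x → (- x) + x ≡ 0#
    *-assoc  : ∀ x y z → (x * y) * z ≡ x * (y * z)
    *-comm   : ∀ x y → x * y ≡ y * x
    *-identityˡ : ∀ x → 1# * x ≡ x
    distribˡ : ∀ x y z → x * (y + z) ≡ (x * y) + (x * z)
    0≢1      : 0# ≢ 1#
    ⁻¹-inverse : ∀ x → x ≢ 0# → x * (x ⁻¹) ≡ 1#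
    size     : ℕ
    enum     : Carrier ↔ Fin size

module PolyDefs {c : Level} (F : FiniteField c) where
  open FiniteField F

  -- polynomials: coefficient lists, constant term first
  Poly : Set c
  Poly = List Carrier

  coeff : Poly → ℕ → Carrier
  coeff []       _       = 0#
  coeff (a ∷ p)  zero    = a
  coeff (a ∷ p)  (ℕ.suc i) = coeff p i

  -- equality of polynomials (ignores trailing zeros)
  _≈ₚ_ : Poly → Poly → Set c
  p ≈ₚ r = ∀ i → coeff p i ≡ coeff r i

  _+ₚ_ : Poly → Poly → Poly
  []      +ₚ r       = r
  (a ∷ p) +ₚ []      = a ∷ p
  (a ∷ p) +ₚ (b ∷ r) = (a + b) ∷ (p +ₚ r)

  _·ₚ_ : Carrier → Poly → Poly
  k ·ₚ p = map (k *_) p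

  -ₚ_ : Poly → Poly
  -ₚ p = map -_ p

  _*ₚ_ : Poly → Poly → Poly
  []      *ₚ r = []
  (a ∷ p) *ₚ r = (a ·ₚ r) +ₚ (0# ∷ (p *ₚ r))

  _^ₚ_ : Poly → ℕ → Poly
  p ^ₚ zero      = 1# ∷ []
  p ^ₚ ℕ.suc n   = p *ₚ (p ^ₚ n)

  eval : Poly → Carrier → Carrier
  eval []      x = 0#
  eval (a ∷ p) x = a + x * eval p x

  isZero : Poly → Bool
  isZero []      = true
  isZero (a ∷ p) = if does (a ≟ 0#) then isZero p else false

  -- degree (the zero polynomial gets degree 0)
  deg : Poly → ℕ
  deg []      = 0
  deg (a ∷ p) = if isZero p then 0 else ℕ.suc (deg p)

  lc : Poly → Carrier
  lc p = coeff p (deg p)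

  _∣ₚ_ : Poly → Poly → Set c
  d ∣ₚ p = ∃[ k ] ((d *ₚ k) ≈ₚ p)

  X-_ : Carrier → Poly
  X- a = (- a) ∷ 1# ∷ []

  Ord : Carrier → Poly → ℕ → Set c
  Ord a p k = ((X- a) ^ₚ k) ∣ₚ p × ¬ (((X- a) ^ₚ ℕ.suc k) ∣ₚ p)

  ValEq : Carrier → Poly → Poly → ℕ → Set c
  ValEq a u v n = ∃[ k ] ∃[ l ] (Ord a u k × Ord a v l × k ≡ l ℕ.+ n)

  rev : ℕ → Poly → Poly
  rev D p = map (λ i → coeff p (D ∸ i)) (upTo (ℕ.suc D))

  Coprime : Poly → Poly → Set c
  Coprime g h = ∀ d → d ∣ₚ g → d ∣ₚ h → deg d ≡ 0

  record RatFun : Set c where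
    constructor _/_[_,_]
    field
      num den  : Poly
      den≢0    : ¬ (den ≈ₚ [])
      coprime  : Coprime num den

  open RatFun public

  degR : RatFun → ℕ
  degR f = deg (num f) ℕ.⊔ deg (den f)

  P1 : Set c
  P1 = Maybe Carrier

  ∞ : P1
  ∞ = nothing

  apply : RatFun → P1 → P1
  apply f (just x) with eval (den f) x ≟ 0#
  ... | yes _ = ∞
  ... | no  _ = just (eval (num f) x * (eval (den f) x ⁻¹))
  apply f nothing =
    if deg (num f) ℕ.<ᵇ deg (den f) then just 0#
    else if deg (den f) ℕ.<ᵇ deg (num f) then ∞
    else just (lc (num f) * (lc (den f) ⁻¹))

  PreimageSize2 : RatFun → P1 → Set c
  PreimageSize2 f α =
    ∃[ x ] ∃[ y ] (x ≢ y × apply f x ≡ α × apply f y ≡ α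
                   × (∀ z → apply f z ≡ α → z ≡ x ⊎ z ≡ y))

  ClassII : RatFun → Set c
  ClassII f = ∃[ α ] PreimageSize2 f α

  -- e_f(a) = n, following the four-case definition.
  --  f(X) - c = (g - c h)/h ;  1/f = h/g ;
  --  f(1/X) = rev D g / rev D h with D = deg f.
  RamIndex : RatFun → P1 → ℕ → Set c
  RamIndex f (just a) n with apply f (just a)
  ... | just c  = ValEq a (num f +ₚ (-ₚ (c ·ₚ den f))) (den f) n
  ... | nothing = ValEq a (den f) (num f) n
  RamIndex f nothing n with apply f nothing
  ... | just c  = ValEq 0# (rev D (num f) +ₚ (-ₚ (c ·ₚ rev D (den f))))
                          (rev D (den f)) n
    where D = degR f
  ... | nothing = ValEq 0# (rev (degR f) (den f)) (rev (degR f) (num f)) n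

  HasRam21 : RatFun → Set c
  HasRam21 f = ∃[ a ] RamIndex f a 2

{-# OPTIONS --safe #-}

-- Write f = g / h. For α on the projective line, f⁻¹(α) is the set of roots on the line of the
-- binary cubic form g - α h (of h when α = ∞), and e_f(a) = 2 says that a is a root of
-- multiplicity exactly 2 of the form belonging to f(a); multiplicities are read off from the
-- Taylor coefficients at a, and at ∞ from those of the reversed polynomial at 0. The lemma thus
-- says that a binary cubic has exactly two roots on the line iff it has a double root. A double
-- root a splits off (z - a)², and the remaining linear factor has exactly one further root.
-- Conversely, after splitting off the factors of two distinct roots a linear factor remains,
-- and its root must again be one of the two, which is therefore double.

module Submission where

open import Level using (Level)
open import Data.Nat using (ℕ)
open import Data.Product using (_×_)
open import Relation.Binary.PropositionalEquality using (_≡_)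
open import Defs

open import Algebra.Bundles using (CommutativeRing; RawRing)
import Algebra.Solver.Ring
import Algebra.Solver.Ring.AlmostCommutativeRing as ACR
open import Data.Bool using (true; false; if_then_else_)
open import Data.Empty using (⊥; ⊥-elim)
open import Data.Integer as ℤ using (ℤ; -[1+_]; sign; ∣_∣)
import Data.Integer.Properties as ℤ
open import Data.List using ([]; _∷_)
open import Data.Maybe using (Maybe; just; nothing)
open import Data.Maybe.Properties using (just-injective)
open import Data.Nat as ℕ using (zero; suc)
import Data.Nat.Properties as ℕ
open import Data.Product using (_,_; ∃-syntax; proj₁; proj₂)
open import Data.Sign as Sign using (Sign)
open import Data.Sum as Sum using (_⊎_; inj₁; inj₂; [_,_]′)
open import Function.Base using (_∘_)
open import Function.Bundles using (_⇔_; mk⇔; Equivalence)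
import Function.Properties.Equivalence as ⇔
open import Relation.Binary.Bundles using (Setoid)
open import Relation.Binary.PropositionalEquality
  using (_≢_; refl; sym; trans; cong; cong₂; subst; isEquivalence; module ≡-Reasoning)
import Relation.Binary.Reasoning.Setoid
open import Relation.Nullary using (¬_; yes; no)

module FieldLemmas {c : Level} (F : FiniteField c) where
  open FiniteField F

  infixl 6 _-_
  _-_ : Carrier → Carrier → Carrier
  x - y = x + - y

  +-identityʳ : ∀ x → x + 0# ≡ x
  +-identityʳ x = trans (+-comm x 0#) (+-identityˡ x)

  -‿inverseʳ : ∀ x → x - x ≡ 0#
  -‿inverseʳ x = trans (+-comm x (- x)) (-‿inverseˡ x)

  *-identityʳ : ∀ x → x * 1# ≡ x
  *-identityʳ x = trans (*-comm x 1#) (*-identityˡ x)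

  distribʳ : ∀ x y z → (y + z) * x ≡ y * x + z * x
  distribʳ x y z = trans (*-comm (y + z) x) (trans (distribˡ x y z) (cong₂ _+_ (*-comm x y) (*-comm x z)))

  commutativeRing : CommutativeRing c c
  commutativeRing = record
    { Carrier = Carrier ; _≈_ = _≡_ ; _+_ = _+_ ; _*_ = _*_ ; -_ = -_ ; 0# = 0# ; 1# = 1#
    ; isCommutativeRing = record
      { isRing = record
        { +-isAbelianGroup = record
          { isGroup = record
            { isMonoid = record
              { isSemigroup = record
                { isMagma = record { isEquivalence = isEquivalence ; ∙-cong = cong₂ _+_ }
                ; assoc = +-assoc }
              ; identity = +-identityˡ , +-identityʳ }
            ; inverse = -‿inverseˡ , -‿inverseʳ
            ; ⁻¹-cong = cong (-_) }
          ; comm = +-comm }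
        ; *-cong = cong₂ _*_
        ; *-assoc = *-assoc
        ; *-identity = *-identityˡ , *-identityʳ
        ; distrib = distribˡ , distribʳ }
      ; *-comm = *-comm } }

  open CommutativeRing commutativeRing public using (zeroˡ; zeroʳ; semiring)
  open import Algebra.Properties.Ring (CommutativeRing.ring commutativeRing) public
    using (-‿distribˡ-*; -‿distribʳ-*; -‿involutive; -0#≈0#)
  open import Algebra.Properties.Semiring.Mult.TCOptimised semiring
    using (×-homo-+; ×1-homo-*; 1+×) renaming (_×_ to _×′_)
  open import Algebra.Properties.AbelianGroup (CommutativeRing.+-abelianGroup commutativeRing)
    using (⁻¹-∙-comm)
  open import Algebra.Properties.CommutativeSemigroup
    (CommutativeRing.+-commutativeSemigroup commutativeRing) public
    using () renaming (interchange to +-interchange)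

  signed : Sign → Carrier → Carrier
  signed Sign.+ x = x
  signed Sign.- x = - x

  signed-* : ∀ s t x y → signed (s Sign.* t) (x * y) ≡ signed s x * signed t y
  signed-* Sign.+ Sign.+ x y = refl
  signed-* Sign.+ Sign.- x y = -‿distribʳ-* x y
  signed-* Sign.- Sign.+ x y = -‿distribˡ-* x y
  signed-* Sign.- Sign.- x y = begin
    x * y             ≡⟨ sym (-‿involutive (x * y)) ⟩
    - - (x * y)       ≡⟨ cong (-_) (-‿distribˡ-* x y) ⟩
    - (- x * y)       ≡⟨ -‿distribʳ-* (- x) y ⟩
    - x * - y         ∎
    where open ≡-Reasoning

  -- The solver normalises with integer coefficients, mapped into F along the
  -- characteristic homomorphism ℤ → F; with F itself as coefficient ring,
  -- coefficients such as (1 + 1) + 1 and 1 + (1 + 1) would not be identified.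
  -- The optimised multiple _×′_ is used so that fromℤ 1 reduces to 1#.
  fromℤ : ℤ → Carrier
  fromℤ (ℤ.+ n)    = n ×′ 1#
  fromℤ -[1+ n ] = - (suc n ×′ 1#)

  fromℤ-⊖ : ∀ m n → fromℤ (m ℤ.⊖ n) ≡ m ×′ 1# - n ×′ 1#
  fromℤ-⊖ m       zero    = begin
    fromℤ (m ℤ.⊖ 0)  ≡⟨ cong fromℤ (ℤ.⊖-≥ {m} {0} ℕ.z≤n) ⟩
    m ×′ 1#           ≡⟨ sym (+-identityʳ _) ⟩
    m ×′ 1# + 0#      ≡⟨ cong ((m ×′ 1#) +_) (sym -0#≈0#) ⟩
    m ×′ 1# - 0#      ∎
    where open ≡-Reasoning
  fromℤ-⊖ zero    (suc n) = sym (+-identityˡ _)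
  fromℤ-⊖ (suc m) (suc n) = begin
    fromℤ (suc m ℤ.⊖ suc n)                ≡⟨ cong fromℤ (ℤ.[1+m]⊖[1+n]≡m⊖n m n) ⟩
    fromℤ (m ℤ.⊖ n)                        ≡⟨ fromℤ-⊖ m n ⟩
    x - y                                  ≡⟨ sym (+-identityˡ (x - y)) ⟩
    0# + (x - y)                           ≡⟨ cong (_+ (x - y)) (sym (-‿inverseʳ 1#)) ⟩
    (1# - 1#) + (x - y)                    ≡⟨ +-interchange 1# (- 1#) x (- y) ⟩
    (1# + x) + (- 1# + - y)                ≡⟨ cong ((1# + x) +_) (⁻¹-∙-comm 1# y) ⟩
    (1# + x) - (1# + y)                    ≡⟨ sym (cong₂ _-_ (1+× m 1#) (1+× n 1#)) ⟩
    suc m ×′ 1# - suc n ×′ 1#              ∎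
    where open ≡-Reasoning
          x = m ×′ 1#
          y = n ×′ 1#

  fromℤ-+ : ∀ i j → fromℤ (i ℤ.+ j) ≡ fromℤ i + fromℤ j
  fromℤ-+ (ℤ.+ m)    (ℤ.+ n)    = ×-homo-+ 1# m n
  fromℤ-+ (ℤ.+ m)    -[1+ n ] = fromℤ-⊖ m (suc n)
  fromℤ-+ -[1+ m ] (ℤ.+ n)    = trans (fromℤ-⊖ n (suc m)) (+-comm _ _)
  fromℤ-+ -[1+ m ] -[1+ n ] = begin
    - (suc (suc (m ℕ.+ n)) ×′ 1#)         ≡⟨ cong (λ k → - (k ×′ 1#)) (sym (ℕ.+-suc (suc m) n)) ⟩
    - ((suc m ℕ.+ suc n) ×′ 1#)           ≡⟨ cong (-_) (×-homo-+ 1# (suc m) (suc n)) ⟩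
    - (suc m ×′ 1# + suc n ×′ 1#)          ≡⟨ sym (⁻¹-∙-comm _ _) ⟩
    - (suc m ×′ 1#) + - (suc n ×′ 1#)      ∎
    where open ≡-Reasoning

  fromℤ-◃ : ∀ s n → fromℤ (s ℤ.◃ n) ≡ signed s (n ×′ 1#)
  fromℤ-◃ Sign.- zero    = sym -0#≈0#
  fromℤ-◃ Sign.+ zero    = refl
  fromℤ-◃ Sign.- (suc n) = refl
  fromℤ-◃ Sign.+ (suc n) = refl

  fromℤ-signed : ∀ i → fromℤ i ≡ signed (sign i) (∣ i ∣ ×′ 1#)
  fromℤ-signed (ℤ.+ n)    = refl
  fromℤ-signed -[1+ n ] = refl

  fromℤ-* : ∀ i j → fromℤ (i ℤ.* j) ≡ fromℤ i * fromℤ j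
  fromℤ-* i j = begin
    fromℤ (s ℤ.◃ m ℕ.* n)                          ≡⟨ fromℤ-◃ s (m ℕ.* n) ⟩
    signed s ((m ℕ.* n) ×′ 1#)                     ≡⟨ cong (signed s) (×1-homo-* m n) ⟩
    signed s (m ×′ 1# * n ×′ 1#)                   ≡⟨ signed-* (sign i) (sign j) (m ×′ 1#) (n ×′ 1#) ⟩
    signed (sign i) (m ×′ 1#) * signed (sign j) (n ×′ 1#)  ≡⟨ sym (cong₂ _*_ (fromℤ-signed i) (fromℤ-signed j)) ⟩
    fromℤ i * fromℤ j                              ∎
    where open ≡-Reasoning
          s = sign i Sign.* sign j
          m = ∣ i ∣
          n = ∣ j ∣

  fromℤ-neg : ∀ i → fromℤ (ℤ.- i) ≡ - fromℤ i
  fromℤ-neg (ℤ.+ zero)    = sym -0#≈0#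
  fromℤ-neg (ℤ.+ suc n)   = refl
  fromℤ-neg -[1+ n ]    = sym (-‿involutive _)

  private
    ℤ-rawRing : RawRing _ _
    ℤ-rawRing = record
      { Carrier = ℤ ; _≈_ = _≡_ ; _+_ = ℤ._+_ ; _*_ = ℤ._*_ ; -_ = ℤ.-_ ; 0# = ℤ.+ 0 ; 1# = ℤ.+ 1 }

    fromℤ-morphism : ℤ-rawRing ACR.-Raw-AlmostCommutative⟶ ACR.fromCommutativeRing commutativeRing
    fromℤ-morphism = record
      { ⟦_⟧ = fromℤ ; +-homo = fromℤ-+ ; *-homo = fromℤ-* ; -‿homo = fromℤ-neg
      ; 0-homo = refl ; 1-homo = refl }

    fromℤ-≟ : ∀ i j → Maybe (fromℤ i ≡ fromℤ j)
    fromℤ-≟ i j with i ℤ.≟ j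
    ... | yes refl = just refl
    ... | no _     = nothing

  open Algebra.Solver.Ring ℤ-rawRing (ACR.fromCommutativeRing commutativeRing) fromℤ-morphism fromℤ-≟ public
    using (Polynomial; solve; _:=_; _:+_; _:*_; :-_; _:-_; con)

  :0 :1 : ∀ {n} → Polynomial n
  :0 = con (ℤ.+ 0)
  :1 = con (ℤ.+ 1)

  x-y≡0⇒x≡y : ∀ {x y} → x - y ≡ 0# → x ≡ y
  x-y≡0⇒x≡y {x} {y} x-y≡0 = begin
    x              ≡⟨ solve 2 (λ x y → x := (x :- y) :+ y) refl x y ⟩
    (x - y) + y    ≡⟨ cong (_+ y) x-y≡0 ⟩
    0# + y         ≡⟨ +-identityˡ y ⟩
    y              ∎
    where open ≡-Reasoning

  x*y≡0⇒y≡0 : ∀ {x y} → x ≢ 0# → x * y ≡ 0# → y ≡ 0#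
  x*y≡0⇒y≡0 {x} {y} x≢0 xy≡0 = begin
    y                   ≡⟨ sym (*-identityˡ y) ⟩
    1# * y              ≡⟨ cong (_* y) (sym (⁻¹-inverse x x≢0)) ⟩
    x * x ⁻¹ * y        ≡⟨ solve 3 (λ x x⁻¹ y → x :* x⁻¹ :* y := x⁻¹ :* (x :* y)) refl x (x ⁻¹) y ⟩
    x ⁻¹ * (x * y)      ≡⟨ cong (x ⁻¹ *_) xy≡0 ⟩
    x ⁻¹ * 0#           ≡⟨ zeroʳ (x ⁻¹) ⟩
    0#                  ∎
    where open ≡-Reasoning

  x*y≡0⇒x≡0∨y≡0 : ∀ {x y} → x * y ≡ 0# → x ≡ 0# ⊎ y ≡ 0#
  x*y≡0⇒x≡0∨y≡0 {x} xy≡0 with x ≟ 0#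
  ... | yes x≡0 = inj₁ x≡0
  ... | no  x≢0 = inj₂ (x*y≡0⇒y≡0 x≢0 xy≡0)

  x*y≢0 : ∀ {x y} → x ≢ 0# → y ≢ 0# → x * y ≢ 0#
  x*y≢0 x≢0 y≢0 xy≡0 = y≢0 (x*y≡0⇒y≡0 x≢0 xy≡0)

  *-cancelˡ-≢0 : ∀ {x y z} → x ≢ 0# → x * y ≡ x * z → y ≡ z
  *-cancelˡ-≢0 {x} {y} {z} x≢0 xy≡xz = x-y≡0⇒x≡y (x*y≡0⇒y≡0 x≢0 (begin
    x * (y - z)       ≡⟨ solve 3 (λ x y z → x :* (y :- z) := x :* y :- x :* z) refl x y z ⟩
    x * y - x * z     ≡⟨ cong (_- x * z) xy≡xz ⟩
    x * z - x * z     ≡⟨ -‿inverseʳ (x * z) ⟩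
    0#                ∎))
    where open ≡-Reasoning

  x≢y⇒x-y≢0 : ∀ {x y} → x ≢ y → x - y ≢ 0#
  x≢y⇒x-y≢0 x≢y x-y≡0 = x≢y (x-y≡0⇒x≡y x-y≡0)

  x*y*y⁻¹≡x : ∀ x {y} → y ≢ 0# → x * y * y ⁻¹ ≡ x
  x*y*y⁻¹≡x x {y} y≢0 = begin
    x * y * y ⁻¹       ≡⟨ *-assoc x y (y ⁻¹) ⟩
    x * (y * y ⁻¹)     ≡⟨ cong (x *_) (⁻¹-inverse y y≢0) ⟩
    x * 1#             ≡⟨ *-identityʳ x ⟩
    x                  ∎
    where open ≡-Reasoning

  -x≡0⇒x≡0 : ∀ {x} → - x ≡ 0# → x ≡ 0#
  -x≡0⇒x≡0 {x} -x≡0 = trans (sym (-‿involutive x)) (trans (cong (-_) -x≡0) -0#≈0#)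

  x≡0⇒-x≡0 : ∀ {x} → x ≡ 0# → - x ≡ 0#
  x≡0⇒-x≡0 x≡0 = trans (cong (-_) x≡0) -0#≈0#

  x+1≢x : ∀ x → x + 1# ≢ x
  x+1≢x x x+1≡x = 0≢1 (sym (begin
    1#                ≡⟨ solve 1 (λ x → :1 := (x :+ :1) :- x) refl x ⟩
    (x + 1#) - x      ≡⟨ cong (_- x) x+1≡x ⟩
    x - x             ≡⟨ -‿inverseʳ x ⟩
    0#                ∎))
    where open ≡-Reasoning

  linear-root : ∀ {k} e → k ≢ 0# → ∃[ w ] k * w + e ≡ 0#
  linear-root {k} e k≢0 = - (e * k ⁻¹) , (begin
    k * - (e * k ⁻¹) + e      ≡⟨ solve 3 (λ k e k⁻¹ → k :* (:- (e :* k⁻¹)) :+ e := e :- e :* (k :* k⁻¹)) refl k e (k ⁻¹) ⟩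
    e - e * (k * k ⁻¹)        ≡⟨ cong (λ t → e - e * t) (⁻¹-inverse k k≢0) ⟩
    e - e * 1#                ≡⟨ cong (_-_ e) (*-identityʳ e) ⟩
    e - e                     ≡⟨ -‿inverseʳ e ⟩
    0#                        ∎)
    where open ≡-Reasoning

module Polynomials {c : Level} (F : FiniteField c) where
  open FiniteField F
  open FieldLemmas F
  open PolyDefs F

  infix 4 _≋_

  -- _≈ₚ_ unfolds to a Π-type from which Agda cannot infer the two polynomials;
  -- wrapping it in a record makes them inferable.
  record _≋_ (p r : Poly) : Set c where
    constructor coeffwise
    field coeff-≡ : p ≈ₚ r
  open _≋_ public

  ≋-setoid : Setoid c c
  ≋-setoid = record
    { Carrier = Poly
    ; _≈_ = _≋_
    ; isEquivalence = record
      { refl  = coeffwise λ i → refl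
      ; sym   = λ p≋r → coeffwise λ i → sym (coeff-≡ p≋r i)
      ; trans = λ p≋r r≋s → coeffwise λ i → trans (coeff-≡ p≋r i) (coeff-≡ r≋s i) } }

  open Setoid ≋-setoid public
    using () renaming (refl to ≋-refl; reflexive to ≋-reflexive; sym to ≋-sym; trans to ≋-trans)
  module ≋-Reasoning = Relation.Binary.Reasoning.Setoid ≋-setoid

  ∷-cong : ∀ {x y p r} → x ≡ y → p ≋ r → x ∷ p ≋ y ∷ r
  ∷-cong x≡y p≋r = coeffwise λ { zero → x≡y ; (suc i) → coeff-≡ p≋r i }

  ∷-≋[] : ∀ {x p} → x ≡ 0# → p ≋ [] → x ∷ p ≋ []
  ∷-≋[] x≡0 p≋[] = coeffwise λ { zero → x≡0 ; (suc i) → coeff-≡ p≋[] i }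

  ∷-≋-tail : ∀ {x y p r} → x ∷ p ≋ y ∷ r → p ≋ r
  ∷-≋-tail x∷p≋y∷r = coeffwise λ i → coeff-≡ x∷p≋y∷r (suc i)

  ∷-≋[]-tail : ∀ {x p} → x ∷ p ≋ [] → p ≋ []
  ∷-≋[]-tail x∷p≋[] = coeffwise λ i → coeff-≡ x∷p≋[] (suc i)

  coeff-+ₚ : ∀ p r i → coeff (p +ₚ r) i ≡ coeff p i + coeff r i
  coeff-+ₚ []      r       i       = sym (+-identityˡ _)
  coeff-+ₚ (a ∷ p) []      i       = sym (+-identityʳ _)
  coeff-+ₚ (a ∷ p) (b ∷ r) zero    = refl
  coeff-+ₚ (a ∷ p) (b ∷ r) (suc i) = coeff-+ₚ p r i

  coeff-·ₚ : ∀ k p i → coeff (k ·ₚ p) i ≡ k * coeff p i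
  coeff-·ₚ k []      i       = sym (zeroʳ k)
  coeff-·ₚ k (a ∷ p) zero    = refl
  coeff-·ₚ k (a ∷ p) (suc i) = coeff-·ₚ k p i

  coeff-negₚ : ∀ p i → coeff (-ₚ p) i ≡ - coeff p i
  coeff-negₚ []      i       = sym -0#≈0#
  coeff-negₚ (a ∷ p) zero    = refl
  coeff-negₚ (a ∷ p) (suc i) = coeff-negₚ p i

  +ₚ-cong : ∀ {p p′ r r′} → p ≋ p′ → r ≋ r′ → p +ₚ r ≋ p′ +ₚ r′
  +ₚ-cong {p} {p′} {r} {r′} p≋p′ r≋r′ = coeffwise λ i → begin
    coeff (p +ₚ r) i          ≡⟨ coeff-+ₚ p r i ⟩
    coeff p i + coeff r i     ≡⟨ cong₂ _+_ (coeff-≡ p≋p′ i) (coeff-≡ r≋r′ i) ⟩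
    coeff p′ i + coeff r′ i   ≡⟨ coeff-+ₚ p′ r′ i ⟨
    coeff (p′ +ₚ r′) i        ∎
    where open ≡-Reasoning

  ·ₚ-cong : ∀ {k p r} → p ≋ r → k ·ₚ p ≋ k ·ₚ r
  ·ₚ-cong {k} {p} {r} p≋r = coeffwise λ i → begin
    coeff (k ·ₚ p) i    ≡⟨ coeff-·ₚ k p i ⟩
    k * coeff p i       ≡⟨ cong (k *_) (coeff-≡ p≋r i) ⟩
    k * coeff r i       ≡⟨ coeff-·ₚ k r i ⟨
    coeff (k ·ₚ r) i    ∎
    where open ≡-Reasoning

  -ₚ-cong : ∀ {p r} → p ≋ r → -ₚ p ≋ -ₚ r
  -ₚ-cong {p} {r} p≋r = coeffwise λ i → trans (coeff-negₚ p i) (trans (cong (-_) (coeff-≡ p≋r i)) (sym (coeff-negₚ r i)))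

  +ₚ-interchange : ∀ p q r s → (p +ₚ q) +ₚ (r +ₚ s) ≋ (p +ₚ r) +ₚ (q +ₚ s)
  +ₚ-interchange p q r s = coeffwise λ i → begin
    coeff ((p +ₚ q) +ₚ (r +ₚ s)) i                      ≡⟨ coeff-+ₚ (p +ₚ q) (r +ₚ s) i ⟩
    coeff (p +ₚ q) i + coeff (r +ₚ s) i                 ≡⟨ cong₂ _+_ (coeff-+ₚ p q i) (coeff-+ₚ r s i) ⟩
    (coeff p i + coeff q i) + (coeff r i + coeff s i)   ≡⟨ +-interchange _ _ _ _ ⟩
    (coeff p i + coeff r i) + (coeff q i + coeff s i)   ≡⟨ cong₂ _+_ (coeff-+ₚ p r i) (coeff-+ₚ q s i) ⟨
    coeff (p +ₚ r) i + coeff (q +ₚ s) i                 ≡⟨ coeff-+ₚ (p +ₚ r) (q +ₚ s) i ⟨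
    coeff ((p +ₚ r) +ₚ (q +ₚ s)) i                      ∎
    where open ≡-Reasoning

  ·ₚ-distribʳ : ∀ a b p → (a + b) ·ₚ p ≋ (a ·ₚ p) +ₚ (b ·ₚ p)
  ·ₚ-distribʳ a b p = coeffwise λ i → begin
    coeff ((a + b) ·ₚ p) i                   ≡⟨ coeff-·ₚ (a + b) p i ⟩
    (a + b) * coeff p i                      ≡⟨ distribʳ (coeff p i) a b ⟩
    a * coeff p i + b * coeff p i            ≡⟨ cong₂ _+_ (coeff-·ₚ a p i) (coeff-·ₚ b p i) ⟨
    coeff (a ·ₚ p) i + coeff (b ·ₚ p) i      ≡⟨ coeff-+ₚ (a ·ₚ p) (b ·ₚ p) i ⟨
    coeff ((a ·ₚ p) +ₚ (b ·ₚ p)) i           ∎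
    where open ≡-Reasoning

  ·ₚ-distribˡ : ∀ k p r → k ·ₚ (p +ₚ r) ≋ (k ·ₚ p) +ₚ (k ·ₚ r)
  ·ₚ-distribˡ k p r = coeffwise λ i → begin
    coeff (k ·ₚ (p +ₚ r)) i                  ≡⟨ coeff-·ₚ k (p +ₚ r) i ⟩
    k * coeff (p +ₚ r) i                     ≡⟨ cong (k *_) (coeff-+ₚ p r i) ⟩
    k * (coeff p i + coeff r i)              ≡⟨ distribˡ k (coeff p i) (coeff r i) ⟩
    k * coeff p i + k * coeff r i            ≡⟨ cong₂ _+_ (coeff-·ₚ k p i) (coeff-·ₚ k r i) ⟨
    coeff (k ·ₚ p) i + coeff (k ·ₚ r) i      ≡⟨ coeff-+ₚ (k ·ₚ p) (k ·ₚ r) i ⟨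
    coeff ((k ·ₚ p) +ₚ (k ·ₚ r)) i           ∎
    where open ≡-Reasoning

  ·ₚ-assoc : ∀ k a p → (k * a) ·ₚ p ≋ k ·ₚ (a ·ₚ p)
  ·ₚ-assoc k a p = coeffwise λ i → begin
    coeff ((k * a) ·ₚ p) i     ≡⟨ coeff-·ₚ (k * a) p i ⟩
    (k * a) * coeff p i        ≡⟨ *-assoc k a (coeff p i) ⟩
    k * (a * coeff p i)        ≡⟨ cong (k *_) (coeff-·ₚ a p i) ⟨
    k * coeff (a ·ₚ p) i       ≡⟨ coeff-·ₚ k (a ·ₚ p) i ⟨
    coeff (k ·ₚ (a ·ₚ p)) i    ∎
    where open ≡-Reasoning

  0·ₚ≋[] : ∀ p → 0# ·ₚ p ≋ []
  0·ₚ≋[] p = coeffwise λ i → trans (coeff-·ₚ 0# p i) (zeroˡ (coeff p i))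

  1·ₚ≋ : ∀ p → 1# ·ₚ p ≋ p
  1·ₚ≋ p = coeffwise λ i → trans (coeff-·ₚ 1# p i) (*-identityˡ (coeff p i))

  +ₚ-identityʳ : ∀ p → p +ₚ [] ≋ p
  +ₚ-identityʳ p = coeffwise λ i → trans (coeff-+ₚ p [] i) (+-identityʳ (coeff p i))

  eval-≋[] : ∀ {p} x → p ≋ [] → eval p x ≡ 0#
  eval-≋[] {[]}    x p≋[] = refl
  eval-≋[] {a ∷ p} x p≋[] = begin
    a + x * eval p x      ≡⟨ cong₂ (λ u v → u + x * v) (coeff-≡ p≋[] 0) (eval-≋[] x (∷-≋[]-tail p≋[])) ⟩
    0# + x * 0#           ≡⟨ solve 1 (λ x → :0 :+ x :* :0 := :0) refl x ⟩
    0#                    ∎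
    where open ≡-Reasoning

  eval-cong : ∀ {p r} x → p ≋ r → eval p x ≡ eval r x
  eval-cong {[]}    {r}     x p≋r = sym (eval-≋[] x (≋-sym p≋r))
  eval-cong {a ∷ p} {[]}    x p≋r = eval-≋[] x p≋r
  eval-cong {a ∷ p} {b ∷ r} x p≋r =
    cong₂ (λ u v → u + x * v) (coeff-≡ p≋r 0) (eval-cong x (∷-≋-tail p≋r))

  eval-+ₚ : ∀ p r x → eval (p +ₚ r) x ≡ eval p x + eval r x
  eval-+ₚ []      r       x = sym (+-identityˡ _)
  eval-+ₚ (a ∷ p) []      x = sym (+-identityʳ _)
  eval-+ₚ (a ∷ p) (b ∷ r) x = begin
    (a + b) + x * eval (p +ₚ r) x                    ≡⟨ cong (λ t → (a + b) + x * t) (eval-+ₚ p r x) ⟩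
    (a + b) + x * (eval p x + eval r x)              ≡⟨ cong ((a + b) +_) (distribˡ x (eval p x) (eval r x)) ⟩
    (a + b) + (x * eval p x + x * eval r x)          ≡⟨ +-interchange a b (x * eval p x) (x * eval r x) ⟩
    (a + x * eval p x) + (b + x * eval r x)          ∎
    where open ≡-Reasoning

  eval-·ₚ : ∀ k p x → eval (k ·ₚ p) x ≡ k * eval p x
  eval-·ₚ k []      x = sym (zeroʳ k)
  eval-·ₚ k (a ∷ p) x = begin
    k * a + x * eval (k ·ₚ p) x    ≡⟨ cong (λ t → k * a + x * t) (eval-·ₚ k p x) ⟩
    k * a + x * (k * eval p x)     ≡⟨ solve 4 (λ k a x e → k :* a :+ x :* (k :* e) := k :* (a :+ x :* e))
                                              refl k a x (eval p x) ⟩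
    k * (a + x * eval p x)         ∎
    where open ≡-Reasoning

  eval-negₚ : ∀ p x → eval (-ₚ p) x ≡ - eval p x
  eval-negₚ []      x = sym -0#≈0#
  eval-negₚ (a ∷ p) x = begin
    - a + x * eval (-ₚ p) x    ≡⟨ cong (λ t → - a + x * t) (eval-negₚ p x) ⟩
    - a + x * - eval p x       ≡⟨ solve 3 (λ a x e → :- a :+ x :* (:- e) := :- (a :+ x :* e)) refl a x (eval p x) ⟩
    - (a + x * eval p x)       ∎
    where open ≡-Reasoning

  0∷[]≋[] : 0# ∷ [] ≋ []
  0∷[]≋[] = ∷-≋[] refl ≋-refl

  0∷-*ₚ : ∀ p w → (0# ∷ p) *ₚ w ≋ 0# ∷ (p *ₚ w)
  0∷-*ₚ p w = +ₚ-cong (0·ₚ≋[] w) ≋-refl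

  *ₚ-identityˡ : ∀ w → (1# ∷ []) *ₚ w ≋ w
  *ₚ-identityˡ w = ≋-trans (+ₚ-cong (1·ₚ≋ w) 0∷[]≋[]) (+ₚ-identityʳ w)

  ≋[]-*ₚ : ∀ {p} w → p ≋ [] → p *ₚ w ≋ []
  ≋[]-*ₚ {[]}    w p≋[] = ≋-refl
  ≋[]-*ₚ {a ∷ p} w p≋[] = +ₚ-cong a·w≋[] (∷-≋[] refl (≋[]-*ₚ w (∷-≋[]-tail p≋[])))
    where a·w≋[] : a ·ₚ w ≋ []
          a·w≋[] = subst (λ k → k ·ₚ w ≋ []) (sym (coeff-≡ p≋[] 0)) (0·ₚ≋[] w)

  *ₚ-congˡ : ∀ {p r} w → p ≋ r → p *ₚ w ≋ r *ₚ w
  *ₚ-congˡ {[]}    {r}     w p≋r = ≋-sym (≋[]-*ₚ w (≋-sym p≋r))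
  *ₚ-congˡ {a ∷ p} {[]}    w p≋r = ≋[]-*ₚ w p≋r
  *ₚ-congˡ {a ∷ p} {b ∷ r} w p≋r =
    +ₚ-cong (≋-reflexive (cong (_·ₚ w) (coeff-≡ p≋r 0))) (∷-cong refl (*ₚ-congˡ w (∷-≋-tail p≋r)))

  *ₚ-distribʳ : ∀ p r w → (p +ₚ r) *ₚ w ≋ (p *ₚ w) +ₚ (r *ₚ w)
  *ₚ-distribʳ []      r       w = ≋-refl
  *ₚ-distribʳ (a ∷ p) []      w = ≋-sym (+ₚ-identityʳ _)
  *ₚ-distribʳ (a ∷ p) (b ∷ r) w = begin
    ((a + b) ·ₚ w) +ₚ (0# ∷ ((p +ₚ r) *ₚ w))
      ≈⟨ +ₚ-cong (·ₚ-distribʳ a b w) (∷-cong (sym (+-identityʳ 0#)) (*ₚ-distribʳ p r w)) ⟩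
    ((a ·ₚ w) +ₚ (b ·ₚ w)) +ₚ ((0# ∷ (p *ₚ w)) +ₚ (0# ∷ (r *ₚ w)))
      ≈⟨ +ₚ-interchange (a ·ₚ w) (b ·ₚ w) (0# ∷ (p *ₚ w)) (0# ∷ (r *ₚ w)) ⟩
    ((a ·ₚ w) +ₚ (0# ∷ (p *ₚ w))) +ₚ ((b ·ₚ w) +ₚ (0# ∷ (r *ₚ w)))
      ∎
    where open ≋-Reasoning

  ·ₚ-*ₚ-assoc : ∀ k p w → (k ·ₚ p) *ₚ w ≋ k ·ₚ (p *ₚ w)
  ·ₚ-*ₚ-assoc k []      w = ≋-refl
  ·ₚ-*ₚ-assoc k (a ∷ p) w = begin
    ((k * a) ·ₚ w) +ₚ (0# ∷ ((k ·ₚ p) *ₚ w))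
      ≈⟨ +ₚ-cong (·ₚ-assoc k a w) (∷-cong (sym (zeroʳ k)) (·ₚ-*ₚ-assoc k p w)) ⟩
    (k ·ₚ (a ·ₚ w)) +ₚ (k ·ₚ (0# ∷ (p *ₚ w)))
      ≈⟨ ≋-sym (·ₚ-distribˡ k (a ·ₚ w) (0# ∷ (p *ₚ w))) ⟩
    k ·ₚ ((a ·ₚ w) +ₚ (0# ∷ (p *ₚ w)))
      ∎
    where open ≋-Reasoning

  X-*ₚ : ∀ a w → (X- a) *ₚ w ≋ ((- a) ·ₚ w) +ₚ (0# ∷ w)
  X-*ₚ a w = +ₚ-cong ≋-refl (∷-cong refl (*ₚ-identityˡ w))

  X-*ₚ-assoc : ∀ a m w → ((X- a) *ₚ m) *ₚ w ≋ (X- a) *ₚ (m *ₚ w)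
  X-*ₚ-assoc a m w = begin
    ((X- a) *ₚ m) *ₚ w                           ≈⟨ *ₚ-congˡ w (X-*ₚ a m) ⟩
    (((- a) ·ₚ m) +ₚ (0# ∷ m)) *ₚ w              ≈⟨ *ₚ-distribʳ ((- a) ·ₚ m) (0# ∷ m) w ⟩
    (((- a) ·ₚ m) *ₚ w) +ₚ ((0# ∷ m) *ₚ w)       ≈⟨ +ₚ-cong (·ₚ-*ₚ-assoc (- a) m w) (0∷-*ₚ m w) ⟩
    ((- a) ·ₚ (m *ₚ w)) +ₚ (0# ∷ (m *ₚ w))       ≈⟨ ≋-sym (X-*ₚ a (m *ₚ w)) ⟩
    (X- a) *ₚ (m *ₚ w)                           ∎
    where open ≋-Reasoning

  X-*ₚ-congʳ : ∀ a {p r} → p ≋ r → (X- a) *ₚ p ≋ (X- a) *ₚ r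
  X-*ₚ-congʳ a {p} {r} p≋r = begin
    (X- a) *ₚ p                       ≈⟨ X-*ₚ a p ⟩
    ((- a) ·ₚ p) +ₚ (0# ∷ p)          ≈⟨ +ₚ-cong (·ₚ-cong p≋r) (∷-cong refl p≋r) ⟩
    ((- a) ·ₚ r) +ₚ (0# ∷ r)          ≈⟨ ≋-sym (X-*ₚ a r) ⟩
    (X- a) *ₚ r                       ∎
    where open ≋-Reasoning

  eval-X-*ₚ : ∀ a w → eval ((X- a) *ₚ w) a ≡ 0#
  eval-X-*ₚ a w = begin
    eval ((X- a) *ₚ w) a                         ≡⟨ eval-cong a (X-*ₚ a w) ⟩
    eval (((- a) ·ₚ w) +ₚ (0# ∷ w)) a            ≡⟨ eval-+ₚ ((- a) ·ₚ w) (0# ∷ w) a ⟩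
    eval ((- a) ·ₚ w) a + (0# + a * eval w a)    ≡⟨ cong (_+ (0# + a * eval w a)) (eval-·ₚ (- a) w a) ⟩
    - a * eval w a + (0# + a * eval w a)         ≡⟨ solve 2 (λ a e → :- a :* e :+ (:0 :+ a :* e) := :0) refl a (eval w a) ⟩
    0#                                           ∎
    where open ≡-Reasoning

  synDiv : Carrier → Poly → Poly
  synDiv a []      = []
  synDiv a (_ ∷ p) = eval p a ∷ synDiv a p

  synDiv-remainder : ∀ a p → ((- a) ·ₚ synDiv a p) +ₚ (eval p a ∷ synDiv a p) ≋ p
  synDiv-remainder a []       = 0∷[]≋[]
  synDiv-remainder a (p₀ ∷ p) = ∷-cong
    (solve 3 (λ a e p₀ → :- a :* e :+ (p₀ :+ a :* e) := p₀) refl a (eval p a) p₀)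
    (synDiv-remainder a p)

  factor-theorem : ∀ {a p} → eval p a ≡ 0# → (X- a) *ₚ synDiv a p ≋ p
  factor-theorem {a} {p} p[a]≡0 = begin
    (X- a) *ₚ q                         ≈⟨ X-*ₚ a q ⟩
    ((- a) ·ₚ q) +ₚ (0# ∷ q)            ≡⟨ cong (λ t → ((- a) ·ₚ q) +ₚ (t ∷ q)) (sym p[a]≡0) ⟩
    ((- a) ·ₚ q) +ₚ (eval p a ∷ q)      ≈⟨ synDiv-remainder a p ⟩
    p                                   ∎
    where open ≋-Reasoning
          q = synDiv a p

  synDiv-cong : ∀ a {p r} → p ≋ r → synDiv a p ≋ synDiv a r
  synDiv-cong a {[]}    {[]}    p≋r = ≋-refl
  synDiv-cong a {[]}    {y ∷ r} p≋r =
    ≋-sym (∷-≋[] (eval-≋[] a r≋[]) (≋-sym (synDiv-cong a {[]} {r} (≋-sym r≋[]))))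
    where r≋[] = ∷-≋[]-tail (≋-sym p≋r)
  synDiv-cong a {x ∷ p} {[]}    p≋r =
    ∷-≋[] (eval-≋[] a (∷-≋[]-tail p≋r)) (synDiv-cong a {p} {[]} (∷-≋[]-tail p≋r))
  synDiv-cong a {x ∷ p} {y ∷ r} p≋r =
    ∷-cong (eval-cong a (∷-≋-tail p≋r)) (synDiv-cong a (∷-≋-tail p≋r))

  synDiv-+ₚ : ∀ a p r → synDiv a (p +ₚ r) ≋ synDiv a p +ₚ synDiv a r
  synDiv-+ₚ a []      r       = ≋-refl
  synDiv-+ₚ a (x ∷ p) []      = ≋-refl
  synDiv-+ₚ a (x ∷ p) (y ∷ r) = ∷-cong (eval-+ₚ p r a) (synDiv-+ₚ a p r)

  synDiv-·ₚ : ∀ a k p → synDiv a (k ·ₚ p) ≋ k ·ₚ synDiv a p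
  synDiv-·ₚ a k []      = ≋-refl
  synDiv-·ₚ a k (x ∷ p) = ∷-cong (eval-·ₚ k p a) (synDiv-·ₚ a k p)

  synDiv-X-*ₚ : ∀ a w → synDiv a ((X- a) *ₚ w) ≋ w
  synDiv-X-*ₚ a w = begin
    synDiv a ((X- a) *ₚ w)                               ≈⟨ synDiv-cong a (X-*ₚ a w) ⟩
    synDiv a (((- a) ·ₚ w) +ₚ (0# ∷ w))                  ≈⟨ synDiv-+ₚ a ((- a) ·ₚ w) (0# ∷ w) ⟩
    synDiv a ((- a) ·ₚ w) +ₚ (eval w a ∷ synDiv a w)     ≈⟨ +ₚ-cong (synDiv-·ₚ a (- a) w) ≋-refl ⟩
    ((- a) ·ₚ synDiv a w) +ₚ (eval w a ∷ synDiv a w)     ≈⟨ synDiv-remainder a w ⟩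
    w                                                    ∎
    where open ≋-Reasoning

  -- taylor j a p is the j-th coefficient of p in powers of (X - a), i.e. its j-th Hasse derivative at a.
  taylor : ℕ → Carrier → Poly → Carrier
  taylor zero    a p = eval p a
  taylor (suc j) a p = taylor j a (synDiv a p)

  taylor-cong : ∀ j a {p r} → p ≋ r → taylor j a p ≡ taylor j a r
  taylor-cong zero    a p≋r = eval-cong a p≋r
  taylor-cong (suc j) a p≋r = taylor-cong j a (synDiv-cong a p≋r)

  X-^ₚ-suc-∣ₚ⇔ : ∀ n a p → ((X- a) ^ₚ suc n) ∣ₚ p ⇔ (eval p a ≡ 0# × ((X- a) ^ₚ n) ∣ₚ synDiv a p)
  X-^ₚ-suc-∣ₚ⇔ n a p = mk⇔ to from
    where
    M = (X- a) ^ₚ n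

    to : ((X- a) ^ₚ suc n) ∣ₚ p → eval p a ≡ 0# × M ∣ₚ synDiv a p
    to (w , [X-a]M*w≈p) = p[a]≡0 , (w , coeff-≡ M*w≋p′)
      where
      X-a*M*w≋p : (X- a) *ₚ (M *ₚ w) ≋ p
      X-a*M*w≋p = ≋-trans (≋-sym (X-*ₚ-assoc a M w)) (coeffwise [X-a]M*w≈p)
      p[a]≡0 : eval p a ≡ 0#
      p[a]≡0 = trans (eval-cong a (≋-sym X-a*M*w≋p)) (eval-X-*ₚ a (M *ₚ w))
      M*w≋p′ : M *ₚ w ≋ synDiv a p
      M*w≋p′ = ≋-trans (≋-sym (synDiv-X-*ₚ a (M *ₚ w))) (synDiv-cong a X-a*M*w≋p)

    from : eval p a ≡ 0# × M ∣ₚ synDiv a p → ((X- a) ^ₚ suc n) ∣ₚ p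
    from (p[a]≡0 , (w , M*w≈p′)) = w , coeff-≡ (begin
      ((X- a) *ₚ M) *ₚ w       ≈⟨ X-*ₚ-assoc a M w ⟩
      (X- a) *ₚ (M *ₚ w)       ≈⟨ X-*ₚ-congʳ a (coeffwise M*w≈p′) ⟩
      (X- a) *ₚ synDiv a p     ≈⟨ factor-theorem p[a]≡0 ⟩
      p                        ∎)
      where open ≋-Reasoning

  X-^ₚ-∣ₚ⇔taylor≡0 : ∀ n a p → ((X- a) ^ₚ n) ∣ₚ p ⇔ (∀ j → j ℕ.< n → taylor j a p ≡ 0#)
  X-^ₚ-∣ₚ⇔taylor≡0 n a p = mk⇔ (to n p) (from n p)
    where
    to : ∀ n p → ((X- a) ^ₚ n) ∣ₚ p → ∀ j → j ℕ.< n → taylor j a p ≡ 0#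
    to zero    p dvd j       ()
    to (suc n) p dvd zero    _       = proj₁ (Equivalence.to (X-^ₚ-suc-∣ₚ⇔ n a p) dvd)
    to (suc n) p dvd (suc j) j<n+1 =
      to n (synDiv a p) (proj₂ (Equivalence.to (X-^ₚ-suc-∣ₚ⇔ n a p) dvd)) j (ℕ.≤-pred j<n+1)

    from : ∀ n p → (∀ j → j ℕ.< n → taylor j a p ≡ 0#) → ((X- a) ^ₚ n) ∣ₚ p
    from zero    p _   = p , coeff-≡ (*ₚ-identityˡ p)
    from (suc n) p t≡0 = Equivalence.from (X-^ₚ-suc-∣ₚ⇔ n a p)
      (t≡0 zero ℕ.z<s , from n (synDiv a p) (λ j j<n → t≡0 (suc j) (ℕ.s<s j<n)))

  Ord⇔taylor : ∀ a p m → Ord a p m ⇔ ((∀ j → j ℕ.< m → taylor j a p ≡ 0#) × taylor m a p ≢ 0#)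
  Ord⇔taylor a p m = mk⇔
    (λ (dvd , ¬dvd) → Dvd.to dvd , λ t≡0 → ¬dvd (Dvd′.from (extend (Dvd.to dvd) t≡0)))
    (λ (t≡0 , t≢0) → Dvd.from t≡0 , λ dvd → t≢0 (Dvd′.to dvd m ℕ.≤-refl))
    where
    module Dvd  = Equivalence (X-^ₚ-∣ₚ⇔taylor≡0 m a p)
    module Dvd′ = Equivalence (X-^ₚ-∣ₚ⇔taylor≡0 (suc m) a p)
    extend : (∀ j → j ℕ.< m → taylor j a p ≡ 0#) → taylor m a p ≡ 0# →
             ∀ j → j ℕ.< suc m → taylor j a p ≡ 0#
    extend t≡0 tm≡0 j j<m+1 with ℕ.m<1+n⇒m<n∨m≡n j<m+1
    ... | inj₁ j<m  = t≡0 j j<m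
    ... | inj₂ refl = tm≡0

  ValEq⇔Ord : ∀ {a n} u v → eval v a ≢ 0# → ValEq a u v n ⇔ Ord a u n
  ValEq⇔Ord {a} {n} u v v[a]≢0 = mk⇔ to from
    where
    to : ValEq a u v n → Ord a u n
    to (k , zero  , ord-u , _     , refl) = ord-u
    to (k , suc l , _     , ord-v , _)    =
      ⊥-elim (v[a]≢0 (proj₁ (Equivalence.to (Ord⇔taylor a v (suc l)) ord-v) zero ℕ.z<s))
    from : Ord a u n → ValEq a u v n
    from ord-u = n , 0 , ord-u , Equivalence.from (Ord⇔taylor a v 0) ((λ j ()) , v[a]≢0) , refl

  isZero⇒≋[] : ∀ p → isZero p ≡ true → p ≋ []
  isZero⇒≋[] []      _  = ≋-refl
  isZero⇒≋[] (a ∷ p) eq with a ≟ 0#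
  isZero⇒≋[] (a ∷ p) eq | yes a≡0 = ∷-≋[] a≡0 (isZero⇒≋[] p eq)
  isZero⇒≋[] (a ∷ p) () | no  _

  coeff-deg< : ∀ p {i} → deg p ℕ.< i → coeff p i ≡ 0#
  coeff-deg< []      _ = refl
  coeff-deg< (a ∷ p) {suc i} deg<i with isZero p in eq
  ... | true  = coeff-≡ (isZero⇒≋[] p eq) i
  ... | false = coeff-deg< p (ℕ.≤-pred deg<i)

  deg≡suc⇒¬isZero : ∀ p {n} → deg p ≡ suc n → isZero p ≡ false
  deg≡suc⇒¬isZero (a ∷ p) deg≡ with isZero p
  deg≡suc⇒¬isZero (a ∷ p) ()   | true
  deg≡suc⇒¬isZero (a ∷ p) deg≡ | false with a ≟ 0#
  ... | yes _ = refl
  ... | no  _ = refl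

  lc≢0 : ∀ p → isZero p ≡ false → lc p ≢ 0#
  lc≢0 (a ∷ p) ¬zero with isZero p in eq
  ... | false = lc≢0 p eq
  ... | true  with a ≟ 0#
  lc≢0 (a ∷ p) () | true | yes _
  lc≢0 (a ∷ p) _  | true | no a≢0 = a≢0

  coeff-deg≢0 : ∀ p {n} → deg p ≡ suc n → coeff p (suc n) ≢ 0#
  coeff-deg≢0 p deg≡ = subst (λ d → coeff p d ≢ 0#) deg≡ (lc≢0 p (deg≡suc⇒¬isZero p deg≡))

  deg-X- : ∀ a → deg (X- a) ≡ 1
  deg-X- a with 1# ≟ 0#
  ... | yes 1≡0 = ⊥-elim (0≢1 (sym 1≡0))
  ... | no  _   = refl

  X-∣ₚ : ∀ {a} p → eval p a ≡ 0# → (X- a) ∣ₚ p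
  X-∣ₚ {a} p p[a]≡0 = synDiv a p , coeff-≡ (factor-theorem {a} {p} p[a]≡0)

  coprime⇒¬common-root : ∀ g h {x} → Coprime g h → eval g x ≡ 0# → eval h x ≡ 0# → ⊥
  coprime⇒¬common-root g h {x} coprime g[x]≡0 h[x]≡0
    with trans (sym (deg-X- x)) (coprime (X- x) (X-∣ₚ g g[x]≡0) (X-∣ₚ h h[x]≡0))
  ... | ()

module ProjectiveLine {c : Level} (F : FiniteField c) where
  open FiniteField F
  open FieldLemmas F
  open PolyDefs F using (P1)

  ratio : Carrier → Carrier → P1
  ratio G H with H ≟ 0#
  ... | yes _ = nothing
  ... | no  _ = just (G * H ⁻¹)

  -- pointForm α is a linear form vanishing exactly on the homogeneous coordinates of α.
  pointForm : P1 → Carrier → Carrier → Carrier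
  pointForm (just α) G H = G - α * H
  pointForm nothing  G H = H

  IsRatio : P1 → Carrier → Carrier → Set c
  IsRatio α G H = pointForm α G H ≡ 0#

  ¬IsRatio⇒≢0 : ∀ {α G H} → ¬ IsRatio α G H → ¬ (G ≡ 0# × H ≡ 0#)
  ¬IsRatio⇒≢0 {just α}  ¬ratio (refl , refl) = ¬ratio (solve 1 (λ α → :0 :- α :* :0 := :0) refl α)
  ¬IsRatio⇒≢0 {nothing} ¬ratio (_ , H≡0)     = ¬ratio H≡0

  ratio-0 : ∀ {G H} → H ≡ 0# → ratio G H ≡ nothing
  ratio-0 {G} {H} H≡0 with H ≟ 0#
  ... | yes _   = refl
  ... | no  H≢0 = ⊥-elim (H≢0 H≡0)

  ratio-≢0 : ∀ {G H} → H ≢ 0# → ratio G H ≡ just (G * H ⁻¹)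
  ratio-≢0 {G} {H} H≢0 with H ≟ 0#
  ... | yes H≡0 = ⊥-elim (H≢0 H≡0)
  ... | no  _   = refl

  IsRatio⇔ratio≡ : ∀ {α G H} → ¬ (G ≡ 0# × H ≡ 0#) → IsRatio α G H ⇔ ratio G H ≡ α
  IsRatio⇔ratio≡ {α} {G} {H} [G,H]≢0 = mk⇔ (to α) (from α)
    where
    to : ∀ α → IsRatio α G H → ratio G H ≡ α
    to α _ with H ≟ 0#
    to nothing  _      | yes _   = refl
    to (just α) G-αH≡0 | yes H≡0 = ⊥-elim ([G,H]≢0 (G≡0 , H≡0))
      where G≡0 : G ≡ 0#
            G≡0 = trans (x-y≡0⇒x≡y G-αH≡0) (trans (cong (α *_) H≡0) (zeroʳ α))
    to nothing  H≡0    | no  H≢0 = ⊥-elim (H≢0 H≡0)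
    to (just α) G-αH≡0 | no  H≢0 =
      cong just (trans (cong (_* H ⁻¹) (x-y≡0⇒x≡y G-αH≡0)) (x*y*y⁻¹≡x α H≢0))

    from : ∀ α → ratio G H ≡ α → IsRatio α G H
    from α ratio≡α with H ≟ 0#
    from nothing  refl | yes H≡0 = H≡0
    from (just _) refl | no  H≢0 = begin
      G - G * H ⁻¹ * H     ≡⟨ cong (_-_ G) (trans (solve 3 (λ G H H⁻¹ → G :* H⁻¹ :* H := G :* H :* H⁻¹) refl G H (H ⁻¹))
                                                  (x*y*y⁻¹≡x G H≢0)) ⟩
      G - G                ≡⟨ -‿inverseʳ G ⟩
      0#                   ∎
      where open ≡-Reasoning

  poleValue : P1 → Carrier → Carrier → Carrier
  poleValue (just _) G H = H
  poleValue nothing  G H = G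

  poleValue≢0 : ∀ {G H} → ¬ (G ≡ 0# × H ≡ 0#) → poleValue (ratio G H) G H ≢ 0#
  poleValue≢0 {G} {H} [G,H]≢0 with H ≟ 0#
  ... | yes H≡0 = λ G≡0 → [G,H]≢0 (G≡0 , H≡0)
  ... | no  H≢0 = H≢0

module BinaryCubics {c : Level} (F : FiniteField c) where
  open FiniteField F
  open FieldLemmas F
  open PolyDefs F
  open Polynomials F
  open ProjectiveLine F

  -- The form r₀ Y³ + r₁ X Y² + r₂ X² Y + r₃ X³; its roots on the line are the
  -- roots of r₀ + r₁ z + r₂ z² + r₃ z³, together with ∞ when r₃ = 0.
  record Cubic : Set c where
    constructor cubic
    field r₀ r₁ r₂ r₃ : Carrier

  toPoly : Cubic → Poly
  toPoly (cubic r₀ r₁ r₂ r₃) = r₀ ∷ r₁ ∷ r₂ ∷ r₃ ∷ []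

  reverse : Cubic → Cubic
  reverse (cubic r₀ r₁ r₂ r₃) = cubic r₃ r₂ r₁ r₀

  value : Cubic → Carrier → Carrier
  value (cubic r₀ r₁ r₂ r₃) z = r₀ + z * (r₁ + z * (r₂ + z * r₃))

  hasse₁ : Cubic → Carrier → Carrier
  hasse₁ (cubic r₀ r₁ r₂ r₃) a = r₁ + a * (r₂ + r₂) + a * a * (r₃ + r₃ + r₃)

  hasse₂ : Cubic → Carrier → Carrier
  hasse₂ (cubic r₀ r₁ r₂ r₃) a = r₂ + a * (r₃ + r₃ + r₃)

  Root : Cubic → P1 → Set c
  Root u (just z) = value u z ≡ 0#
  Root u nothing  = Cubic.r₃ u ≡ 0#

  DoubleRoot : Cubic → P1 → Set c
  DoubleRoot u (just a) = value u a ≡ 0# × hasse₁ u a ≡ 0# × hasse₂ u a ≢ 0#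
  DoubleRoot u nothing  = Cubic.r₃ u ≡ 0# × Cubic.r₂ u ≡ 0# × Cubic.r₁ u ≢ 0#

  ExactlyTwoRoots : Cubic → P1 → P1 → Set c
  ExactlyTwoRoots u x y = x ≢ y × Root u x × Root u y × (∀ z → Root u z → z ≡ x ⊎ z ≡ y)

  taylor-expansion : ∀ u a z →
    value u z ≡ value u a + (z - a) * (hasse₁ u a + (z - a) * (hasse₂ u a + (z - a) * Cubic.r₃ u))
  taylor-expansion (cubic r₀ r₁ r₂ r₃) a z = solve 6
    (λ r₀ r₁ r₂ r₃ a z →
      r₀ :+ z :* (r₁ :+ z :* (r₂ :+ z :* r₃))
        := (r₀ :+ a :* (r₁ :+ a :* (r₂ :+ a :* r₃)))
           :+ (z :- a) :* ((r₁ :+ a :* (r₂ :+ r₂) :+ a :* a :* (r₃ :+ r₃ :+ r₃))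
           :+ (z :- a) :* ((r₂ :+ a :* (r₃ :+ r₃ :+ r₃)) :+ (z :- a) :* r₃)))
    refl r₀ r₁ r₂ r₃ a z

  taylor₀-toPoly : ∀ u a → taylor 0 a (toPoly u) ≡ value u a
  taylor₀-toPoly (cubic r₀ r₁ r₂ r₃) a = solve 5
    (λ r₀ r₁ r₂ r₃ a → 
      r₀ :+ a :* (r₁ :+ a :* (r₂ :+ a :* (r₃ :+ a :* :0))) := r₀ :+ a :* (r₁ :+ a :* (r₂ :+ a :* r₃)))
    refl r₀ r₁ r₂ r₃ a

  -- The left-hand sides are taylor j a (toPoly u) unfolded; the eᵢ are the coefficients
  -- produced by synthetic division.
  taylor₁-toPoly : ∀ u a → taylor 1 a (toPoly u) ≡ hasse₁ u a
  taylor₁-toPoly (cubic r₀ r₁ r₂ r₃) a = solve 4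
    (λ r₁ r₂ r₃ a → let e₃ = r₃ :+ a :* :0
                        e₂ = r₂ :+ a :* e₃
                        e₁ = r₁ :+ a :* e₂ in
      e₁ :+ a :* (e₂ :+ a :* (e₃ :+ a :* (:0 :+ a :* :0))) := r₁ :+ a :* (r₂ :+ r₂) :+ a :* a :* (r₃ :+ r₃ :+ r₃))
    refl r₁ r₂ r₃ a

  taylor₂-toPoly : ∀ u a → taylor 2 a (toPoly u) ≡ hasse₂ u a
  taylor₂-toPoly (cubic r₀ r₁ r₂ r₃) a = solve 3
    (λ r₂ r₃ a → let e₄ = :0 :+ a :* :0
                     e₃ = r₃ :+ a :* :0
                     e₂ = r₂ :+ a :* e₃ in
      (e₂ :+ a :* (e₃ :+ a :* e₄)) :+ a :* ((e₃ :+ a :* e₄) :+ a :* (e₄ :+ a :* e₄)) := r₂ :+ a :* (r₃ :+ r₃ :+ r₃))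
    refl r₂ r₃ a

  Ord₂⇔DoubleRoot : ∀ {p u} a → p ≋ toPoly u → Ord a p 2 ⇔ DoubleRoot u (just a)
  Ord₂⇔DoubleRoot {p} {u} a p≋u = mk⇔
    (λ ord → let (t≡0 , t₂≢0) = Equivalence.to (Ord⇔taylor a p 2) ord in
      trans (sym t₀) (t≡0 0 ℕ.z<s) , trans (sym t₁) (t≡0 1 (ℕ.s<s ℕ.z<s)) , λ h₂≡0 → t₂≢0 (trans t₂ h₂≡0))
    (λ (v≡0 , h₁≡0 , h₂≢0) → Equivalence.from (Ord⇔taylor a p 2)
      ( (λ { zero _ → trans t₀ v≡0 ; (suc zero) _ → trans t₁ h₁≡0 ; (suc (suc j)) (ℕ.s<s (ℕ.s<s ())) })
      , λ t₂≡0 → h₂≢0 (trans (sym t₂) t₂≡0)))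
    where
    t₀ : taylor 0 a p ≡ value u a
    t₀ = trans (taylor-cong 0 a p≋u) (taylor₀-toPoly u a)
    t₁ : taylor 1 a p ≡ hasse₁ u a
    t₁ = trans (taylor-cong 1 a p≋u) (taylor₁-toPoly u a)
    t₂ : taylor 2 a p ≡ hasse₂ u a
    t₂ = trans (taylor-cong 2 a p≋u) (taylor₂-toPoly u a)

  value-reverse-0 : ∀ u → value (reverse u) 0# ≡ Cubic.r₃ u
  value-reverse-0 (cubic r₀ r₁ r₂ r₃) =
    solve 4 (λ r₃ r₂ r₁ r₀ → r₃ :+ :0 :* (r₂ :+ :0 :* (r₁ :+ :0 :* r₀)) := r₃) refl r₃ r₂ r₁ r₀

  DoubleRoot-∞⇔reverse : ∀ u → DoubleRoot u nothing ⇔ DoubleRoot (reverse u) (just 0#)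
  DoubleRoot-∞⇔reverse u@(cubic r₀ r₁ r₂ r₃) = mk⇔
    (λ (r₃≡0 , r₂≡0 , r₁≢0) → trans v r₃≡0 , trans h₁ r₂≡0 , λ h₂≡0 → r₁≢0 (trans (sym h₂) h₂≡0))
    (λ (v≡0 , h₁≡0 , h₂≢0) → trans (sym v) v≡0 , trans (sym h₁) h₁≡0 , λ r₁≡0 → h₂≢0 (trans h₂ r₁≡0))
    where
    v : value (reverse u) 0# ≡ r₃
    v = value-reverse-0 u
    h₁ : hasse₁ (reverse u) 0# ≡ r₂
    h₁ = solve 3 (λ r₂ r₁ r₀ → r₂ :+ :0 :* (r₁ :+ r₁) :+ :0 :* :0 :* (r₀ :+ r₀ :+ r₀) := r₂)
      refl r₂ r₁ r₀
    h₂ : hasse₂ (reverse u) 0# ≡ r₁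
    h₂ = solve 2 (λ r₁ r₀ → r₁ :+ :0 :* (r₀ :+ r₀ :+ r₀) := r₁) refl r₁ r₀

  exactlyTwoRoots-from-ratio : ∀ {u x G H} → ¬ IsRatio x G H →
    (∀ z → Root u z ⇔ (z ≡ x ⊎ IsRatio z G H)) → ExactlyTwoRoots u x (ratio G H)
  exactlyTwoRoots-from-ratio {u} {x} {G} {H} ¬ratio roots = x≢y , root-x , root-y , only
    where
    ratio⇔ : ∀ {α} → IsRatio α G H ⇔ ratio G H ≡ α
    ratio⇔ = IsRatio⇔ratio≡ (¬IsRatio⇒≢0 {x} ¬ratio)
    x≢y : x ≢ ratio G H
    x≢y x≡y = ¬ratio (Equivalence.from ratio⇔ (sym x≡y))
    root-x : Root u x
    root-x = Equivalence.from (roots x) (inj₁ refl)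
    root-y : Root u (ratio G H)
    root-y = Equivalence.from (roots (ratio G H)) (inj₂ (Equivalence.from ratio⇔ refl))
    only : ∀ z → Root u z → z ≡ x ⊎ z ≡ ratio G H
    only z root-z with Equivalence.to (roots z) root-z
    ... | inj₁ z≡x     = inj₁ z≡x
    ... | inj₂ ratio-z = inj₂ (sym (Equivalence.to ratio⇔ ratio-z))

  doubleRoot-factor : ∀ {u a} z → value u a ≡ 0# → hasse₁ u a ≡ 0# →
    value u z ≡ (z - a) * ((z - a) * (hasse₂ u a + (z - a) * Cubic.r₃ u))
  doubleRoot-factor {u} {a} z v≡0 h₁≡0 = begin
    value u z                                 ≡⟨ taylor-expansion u a z ⟩
    value u a + s * (hasse₁ u a + s * ℓ)      ≡⟨ cong₂ (λ v h → v + s * (h + s * ℓ)) v≡0 h₁≡0 ⟩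
    0# + s * (0# + s * ℓ)                     ≡⟨ solve 2 (λ s ℓ → :0 :+ s :* (:0 :+ s :* ℓ) := s :* (s :* ℓ)) refl s ℓ ⟩
    s * (s * ℓ)                               ∎
    where open ≡-Reasoning
          s = z - a
          ℓ = hasse₂ u a + (z - a) * Cubic.r₃ u

  -- At a double root a the cubic is (z - a)² ℓ(z) with ℓ linear; the other root is that of ℓ.
  roots-of-finite-doubleRoot : ∀ {u a} → DoubleRoot u (just a) → ∀ z →
    Root u z ⇔ (z ≡ just a ⊎ IsRatio z (Cubic.r₃ u * a - hasse₂ u a) (Cubic.r₃ u))
  roots-of-finite-doubleRoot {u} {a} (v≡0 , h₁≡0 , _) nothing = mk⇔ inj₂ λ { (inj₁ ()) ; (inj₂ r₃≡0) → r₃≡0 }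
  roots-of-finite-doubleRoot {u} {a} (v≡0 , h₁≡0 , _) (just z) = mk⇔ to from
    where
    r₃ = Cubic.r₃ u
    ℓ = hasse₂ u a + (z - a) * r₃
    ratio≡-ℓ : (r₃ * a - hasse₂ u a) - z * r₃ ≡ - ℓ
    ratio≡-ℓ = solve 4 (λ r₃ a h z → (r₃ :* a :- h) :- z :* r₃ := :- (h :+ (z :- a) :* r₃)) refl r₃ a (hasse₂ u a) z
    to : value u z ≡ 0# → just z ≡ just a ⊎ (r₃ * a - hasse₂ u a) - z * r₃ ≡ 0#
    to v[z]≡0 = Sum.map (cong just ∘ x-y≡0⇒x≡y) (λ ℓ≡0 → trans ratio≡-ℓ (x≡0⇒-x≡0 ℓ≡0))
      ([ inj₁ , x*y≡0⇒x≡0∨y≡0 ]′ (x*y≡0⇒x≡0∨y≡0 (trans (sym (doubleRoot-factor z v≡0 h₁≡0)) v[z]≡0)))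
    from : just z ≡ just a ⊎ (r₃ * a - hasse₂ u a) - z * r₃ ≡ 0# → value u z ≡ 0#
    from (inj₁ refl)  = v≡0
    from (inj₂ ratio) = begin
      value u z                ≡⟨ doubleRoot-factor z v≡0 h₁≡0 ⟩
      (z - a) * ((z - a) * ℓ)  ≡⟨ cong (λ t → (z - a) * ((z - a) * t)) (-x≡0⇒x≡0 (trans (sym ratio≡-ℓ) ratio)) ⟩
      (z - a) * ((z - a) * 0#) ≡⟨ solve 1 (λ s → s :* (s :* :0) := :0) refl (z - a) ⟩
      0#                       ∎
      where open ≡-Reasoning

  roots-of-∞-doubleRoot : ∀ {u} → DoubleRoot u nothing → ∀ z →
    Root u z ⇔ (z ≡ nothing ⊎ IsRatio z (- Cubic.r₀ u) (Cubic.r₁ u))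
  roots-of-∞-doubleRoot {cubic r₀ r₁ r₂ r₃} (r₃≡0 , _ , _) nothing = mk⇔ (λ _ → inj₁ refl) (λ _ → r₃≡0)
  roots-of-∞-doubleRoot {cubic r₀ r₁ r₂ r₃} (refl , refl , _) (just z) = mk⇔
    (λ v≡0 → inj₂ (trans ratio≡-v (x≡0⇒-x≡0 v≡0)))
    (λ { (inj₁ ()) ; (inj₂ ratio) → -x≡0⇒x≡0 (trans (sym ratio≡-v) ratio) })
    where
    ratio≡-v : - r₀ - z * r₁ ≡ - value (cubic r₀ r₁ 0# 0#) z
    ratio≡-v = solve 3 (λ r₀ r₁ z → 
      :- r₀ :- z :* r₁ := :- (r₀ :+ z :* (r₁ :+ z :* (:0 :+ z :* :0)))) refl r₀ r₁ z

  doubleRoot⇒exactlyTwoRoots : ∀ {u x} → DoubleRoot u x → ∃[ y ] ExactlyTwoRoots u x y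
  doubleRoot⇒exactlyTwoRoots {u} {just a} double@(_ , _ , h₂≢0) =
    _ , exactlyTwoRoots-from-ratio ¬ratio (roots-of-finite-doubleRoot double)
    where
    ¬ratio : ¬ IsRatio (just a) (Cubic.r₃ u * a - hasse₂ u a) (Cubic.r₃ u)
    ¬ratio ratio = h₂≢0 (-x≡0⇒x≡0 (trans (sym -h₂≡) ratio))
      where -h₂≡ : (Cubic.r₃ u * a - hasse₂ u a) - a * Cubic.r₃ u ≡ - hasse₂ u a
            -h₂≡ = solve 3 (λ r₃ a h → (r₃ :* a :- h) :- a :* r₃ := :- h) refl (Cubic.r₃ u) a (hasse₂ u a)
  doubleRoot⇒exactlyTwoRoots {u} {nothing} double@(_ , _ , r₁≢0) =
    _ , exactlyTwoRoots-from-ratio r₁≢0 (roots-of-∞-doubleRoot double)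

  -- Interpolating the linear remainder of the division by (z - a)(z - b) through its values at a and b.
  lagrange : ∀ u a b z → let k = Cubic.r₂ u + Cubic.r₃ u * (a + b) in
    (a - b) * value u z
      ≡ (a - b) * ((z - a) * ((z - b) * (Cubic.r₃ u * z + k))) + (value u a * (z - b) - value u b * (z - a))
  lagrange (cubic r₀ r₁ r₂ r₃) a b z = solve 7
    (λ r₀ r₁ r₂ r₃ a b z →
      let val = λ t → r₀ :+ t :* (r₁ :+ t :* (r₂ :+ t :* r₃)) in
      (a :- b) :* val z
        := (a :- b) :* ((z :- a) :* ((z :- b) :* (r₃ :* z :+ (r₂ :+ r₃ :* (a :+ b)))))
           :+ (val a :* (z :- b) :- val b :* (z :- a)))
    refl r₀ r₁ r₂ r₃ a b z


  two-roots-factor : ∀ {u a b} z → a ≢ b → value u a ≡ 0# → value u b ≡ 0# →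
    value u z ≡ (z - a) * ((z - b) * (Cubic.r₃ u * z + (Cubic.r₂ u + Cubic.r₃ u * (a + b))))
  two-roots-factor {u} {a} {b} z a≢b va≡0 vb≡0 = *-cancelˡ-≢0 (x≢y⇒x-y≢0 a≢b) (begin
    (a - b) * value u z
      ≡⟨ lagrange u a b z ⟩
    (a - b) * P + (value u a * (z - b) - value u b * (z - a))
      ≡⟨ cong₂ (λ s t → (a - b) * P + (s * (z - b) - t * (z - a))) va≡0 vb≡0 ⟩
    (a - b) * P + (0# * (z - b) - 0# * (z - a))
      ≡⟨ solve 4 (λ a b z P → (a :- b) :* P :+ (:0 :* (z :- b) :- :0 :* (z :- a)) := (a :- b) :* P) refl a b z P ⟩
    (a - b) * P ∎)
    where open ≡-Reasoning
          P = (z - a) * ((z - b) * (Cubic.r₃ u * z + (Cubic.r₂ u + Cubic.r₃ u * (a + b))))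

  doubleRoot-from-third-root : ∀ {u a b} → a ≢ b → Cubic.r₃ u ≢ 0# → value u a ≡ 0# → value u b ≡ 0# →
    Cubic.r₃ u * a + (Cubic.r₂ u + Cubic.r₃ u * (a + b)) ≡ 0# → DoubleRoot u (just a)
  doubleRoot-from-third-root {cubic r₀ r₁ r₂ r₃} {a} {b} a≢b r₃≢0 va≡0 vb≡0 ℓa≡0 = va≡0 , h₁≡0 , h₂≢0
    where
    u = cubic r₀ r₁ r₂ r₃
    ℓa = r₃ * a + (r₂ + r₃ * (a + b))
    open ≡-Reasoning
    h₁≡0 : hasse₁ u a ≡ 0#
    h₁≡0 = x*y≡0⇒y≡0 (x≢y⇒x-y≢0 (λ b≡a → a≢b (sym b≡a))) (begin
      (b - a) * hasse₁ u a
        ≡⟨ solve 6 (λ r₀ r₁ r₂ r₃ a b →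
             let val = λ t → r₀ :+ t :* (r₁ :+ t :* (r₂ :+ t :* r₃)) in
             (b :- a) :* (r₁ :+ a :* (r₂ :+ r₂) :+ a :* a :* (r₃ :+ r₃ :+ r₃))
               := (val b :- val a) :- (b :- a) :* ((b :- a) :* (r₃ :* a :+ (r₂ :+ r₃ :* (a :+ b)))))
             refl r₀ r₁ r₂ r₃ a b ⟩
      (value u b - value u a) - (b - a) * ((b - a) * ℓa)
        ≡⟨ cong₂ (λ s t → s - (b - a) * ((b - a) * t)) (cong₂ _-_ vb≡0 va≡0) ℓa≡0 ⟩
      (0# - 0#) - (b - a) * ((b - a) * 0#)
        ≡⟨ solve 1 (λ s → (:0 :- :0) :- s :* (s :* :0) := :0) refl (b - a) ⟩
      0# ∎)
    h₂≢0 : hasse₂ u a ≢ 0#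
    h₂≢0 h₂≡0 = x*y≢0 r₃≢0 (x≢y⇒x-y≢0 a≢b) (begin
      r₃ * (a - b)
        ≡⟨ solve 4 (λ r₂ r₃ a b → r₃ :* (a :- b) := (r₂ :+ a :* (r₃ :+ r₃ :+ r₃)) :- (r₃ :* a :+ (r₂ :+ r₃ :* (a :+ b))))
                   refl r₂ r₃ a b ⟩
      hasse₂ u a - ℓa
        ≡⟨ cong₂ _-_ h₂≡0 ℓa≡0 ⟩
      0# - 0#
        ≡⟨ -‿inverseʳ 0# ⟩
      0# ∎)

  -- The root w of the linear factor in two-roots-factor is a third root, so w is a or b.
  finite-roots⇒doubleRoot : ∀ {u a b} → a ≢ b → Cubic.r₃ u ≢ 0# → value u a ≡ 0# → value u b ≡ 0# →
    (∀ w → value u w ≡ 0# → w ≡ a ⊎ w ≡ b) → DoubleRoot u (just a) ⊎ DoubleRoot u (just b)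
  finite-roots⇒doubleRoot {u} {a} {b} a≢b r₃≢0 va≡0 vb≡0 only =
    let (w , ℓw≡0) = linear-root k r₃≢0 in
    Sum.map (λ w≡a → doubleRoot-from-third-root a≢b r₃≢0 va≡0 vb≡0 (subst (λ t → r₃ * t + k ≡ 0#) w≡a ℓw≡0))
            (λ w≡b → doubleRoot-from-third-root (λ b≡a → a≢b (sym b≡a)) r₃≢0 vb≡0 va≡0
                       (trans (cong (λ t → r₃ * b + (Cubic.r₂ u + r₃ * t)) (+-comm b a))
                              (subst (λ t → r₃ * t + k ≡ 0#) w≡b ℓw≡0)))
            (only w (third-root w ℓw≡0))
    where
    r₃ = Cubic.r₃ u
    k = Cubic.r₂ u + r₃ * (a + b)
    third-root : ∀ w → r₃ * w + k ≡ 0# → value u w ≡ 0#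
    third-root w ℓw≡0 = begin
      value u w                         ≡⟨ two-roots-factor w a≢b va≡0 vb≡0 ⟩
      (w - a) * ((w - b) * (r₃ * w + k)) ≡⟨ cong (λ t → (w - a) * ((w - b) * t)) ℓw≡0 ⟩
      (w - a) * ((w - b) * 0#)          ≡⟨ solve 2 (λ s t → s :* (t :* :0) := :0) refl (w - a) (w - b) ⟩
      0#                                ∎
      where open ≡-Reasoning

  -- With r₃ = 0 the cubic is (z - a)(r₂ z + k); the root of r₂ z + k is finite, hence equal to a.
  quadratic-root⇒doubleRoot : ∀ {u a} → Cubic.r₃ u ≡ 0# → Cubic.r₂ u ≢ 0# → value u a ≡ 0# →
    (∀ w → value u w ≡ 0# → w ≡ a) → DoubleRoot u (just a)
  quadratic-root⇒doubleRoot {cubic r₀ r₁ r₂ r₃} {a} refl r₂≢0 va≡0 only =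
    let (w , ℓw≡0) = linear-root k r₂≢0
        ℓa≡0 = subst (λ t → r₂ * t + k ≡ 0#) (only w (second-root w ℓw≡0)) ℓw≡0
    in va≡0 , trans h₁≡ℓa ℓa≡0 , λ h₂≡0 → r₂≢0 (trans h₂≡r₂ h₂≡0)
    where
    u = cubic r₀ r₁ r₂ 0#
    k = r₁ + r₂ * a
    second-root : ∀ w → r₂ * w + k ≡ 0# → value u w ≡ 0#
    second-root w ℓw≡0 = begin
      value u w                          ≡⟨ solve 5 (λ r₀ r₁ r₂ a w →
                                              let val = λ t → r₀ :+ t :* (r₁ :+ t :* (r₂ :+ t :* :0)) in
                                              val w := val a :+ (w :- a) :* (r₂ :* w :+ (r₁ :+ r₂ :* a)))
                                              refl r₀ r₁ r₂ a w ⟩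
      value u a + (w - a) * (r₂ * w + k) ≡⟨ cong₂ (λ s t → s + (w - a) * t) va≡0 ℓw≡0 ⟩
      0# + (w - a) * 0#                  ≡⟨ solve 1 (λ s → :0 :+ s :* :0 := :0) refl (w - a) ⟩
      0#                                 ∎
      where open ≡-Reasoning
    h₁≡ℓa : hasse₁ u a ≡ r₂ * a + k
    h₁≡ℓa = solve 3 (λ r₁ r₂ a → 
      r₁ :+ a :* (r₂ :+ r₂) :+ a :* a :* (:0 :+ :0 :+ :0) := r₂ :* a :+ (r₁ :+ r₂ :* a)) refl r₁ r₂ a
    h₂≡r₂ : r₂ ≡ hasse₂ u a
    h₂≡r₂ = solve 2 (λ r₂ a → r₂ := r₂ :+ a :* (:0 :+ :0 :+ :0)) refl r₂ a

  root-and-∞⇒doubleRoot : ∀ {u a} → Cubic.r₃ u ≡ 0# → value u a ≡ 0# →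
    (∀ w → value u w ≡ 0# → w ≡ a) → DoubleRoot u (just a) ⊎ DoubleRoot u nothing
  root-and-∞⇒doubleRoot {cubic r₀ r₁ r₂ r₃} {a} r₃≡0 va≡0 only with r₂ ≟ 0# | r₁ ≟ 0#
  ... | no r₂≢0  | _        = inj₁ (quadratic-root⇒doubleRoot r₃≡0 r₂≢0 va≡0 only)
  ... | yes r₂≡0 | no r₁≢0  = inj₂ (r₃≡0 , r₂≡0 , r₁≢0)
  ... | yes refl | yes refl = ⊥-elim (x+1≢x a (only (a + 1#) (trans (constant r₃≡0) va≡0)))
    where
    constant : r₃ ≡ 0# → value (cubic r₀ 0# 0# r₃) (a + 1#) ≡ value (cubic r₀ 0# 0# r₃) a
    constant refl = solve 2 (λ r₀ a → let val = λ t → r₀ :+ t :* (:0 :+ t :* (:0 :+ t :* :0)) in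
      val (a :+ :1) := val a) refl r₀ a

  exactlyTwoRoots⇒doubleRoot : ∀ {u x y} → ExactlyTwoRoots u x y → DoubleRoot u x ⊎ DoubleRoot u y
  exactlyTwoRoots⇒doubleRoot {u} {just a} {just b} (x≢y , va≡0 , vb≡0 , only) =
    finite-roots⇒doubleRoot (λ a≡b → x≢y (cong just a≡b)) r₃≢0 va≡0 vb≡0
      (λ w vw≡0 → Sum.map just-injective just-injective (only (just w) vw≡0))
    where r₃≢0 : Cubic.r₃ u ≢ 0#
          r₃≢0 r₃≡0 = [ (λ ()) , (λ ()) ]′ (only nothing r₃≡0)
  exactlyTwoRoots⇒doubleRoot {u} {just a} {nothing} (_ , va≡0 , r₃≡0 , only) =
    root-and-∞⇒doubleRoot r₃≡0 va≡0 (λ w vw≡0 → [ just-injective , (λ ()) ]′ (only (just w) vw≡0))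
  exactlyTwoRoots⇒doubleRoot {u} {nothing} {just b} (_ , r₃≡0 , vb≡0 , only) =
    Sum.swap (root-and-∞⇒doubleRoot r₃≡0 vb≡0 (λ w vw≡0 → [ (λ ()) , just-injective ]′ (only (just w) vw≡0)))
  exactlyTwoRoots⇒doubleRoot {u} {nothing} {nothing} (x≢y , _) = ⊥-elim (x≢y refl)

module DegreeThree {c : Level} (F : FiniteField c) (f : PolyDefs.RatFun F) (deg≡3 : PolyDefs.degR F f ≡ 3) where
  open FiniteField F
  open FieldLemmas F
  open PolyDefs F
  open Polynomials F
  open ProjectiveLine F
  open BinaryCubics F

  g h : Poly
  g = num f
  h = den f

  deg-g≤3 : deg g ℕ.≤ 3
  deg-g≤3 = subst (deg g ℕ.≤_) deg≡3 (ℕ.m≤m⊔n (deg g) (deg h))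

  deg-h≤3 : deg h ℕ.≤ 3
  deg-h≤3 = subst (deg h ℕ.≤_) deg≡3 (ℕ.m≤n⊔m (deg g) (deg h))

  degree-cases : (deg g ≡ 3 × deg h ℕ.< 3) ⊎ (deg g ℕ.≤ 3 × deg h ≡ 3)
  degree-cases with ℕ.m≤n⇒m<n∨m≡n deg-h≤3
  ... | inj₂ deg-h≡3 = inj₂ (deg-g≤3 , deg-h≡3)
  ... | inj₁ deg-h<3 with ℕ.⊔-sel (deg g) (deg h)
  ...   | inj₁ ⊔≡deg-g = inj₁ (trans (sym ⊔≡deg-g) deg≡3 , deg-h<3)
  ...   | inj₂ ⊔≡deg-h = ⊥-elim (ℕ.<-irrefl (trans (sym ⊔≡deg-h) deg≡3) deg-h<3)

  cubicOf : Poly → Cubic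
  cubicOf p = cubic (coeff p 0) (coeff p 1) (coeff p 2) (coeff p 3)

  ≋-cubicOf : ∀ p → deg p ℕ.≤ 3 → p ≋ toPoly (cubicOf p)
  ≋-cubicOf p deg≤3 = coeffwise λ
    { 0 → refl ; 1 → refl ; 2 → refl ; 3 → refl
    ; (suc (suc (suc (suc i)))) → coeff-deg< p (ℕ.s≤s (ℕ.≤-trans deg≤3 (ℕ.m≤m+n 3 i))) }

  fibre : P1 → Cubic
  fibre (just α) = cubic (coeff g 0 - α * coeff h 0) (coeff g 1 - α * coeff h 1)
                         (coeff g 2 - α * coeff h 2) (coeff g 3 - α * coeff h 3)
  fibre nothing  = cubicOf h

  fibrePoly : P1 → Poly
  fibrePoly (just α) = g +ₚ (-ₚ (α ·ₚ h))
  fibrePoly nothing  = h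

  fibrePoly≋ : ∀ α → fibrePoly α ≋ toPoly (fibre α)
  fibrePoly≋ (just α) = +ₚ-cong (≋-cubicOf g deg-g≤3) (-ₚ-cong (·ₚ-cong (≋-cubicOf h deg-h≤3)))
  fibrePoly≋ nothing  = ≋-cubicOf h deg-h≤3

  -- Homogeneous coordinates of (g : h) at a point of the line; at ∞ they are the X³-coefficients.
  numAt denAt : P1 → Carrier
  numAt (just x) = eval g x
  numAt nothing  = coeff g 3
  denAt (just x) = eval h x
  denAt nothing  = coeff h 3

  numAt-denAt-≢0 : ∀ z → ¬ (numAt z ≡ 0# × denAt z ≡ 0#)
  numAt-denAt-≢0 (just x) (g[x]≡0 , h[x]≡0) = coprime⇒¬common-root g h (coprime f) g[x]≡0 h[x]≡0
  numAt-denAt-≢0 nothing  (g₃≡0 , h₃≡0) with degree-cases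
  ... | inj₁ (deg-g≡3 , _) = coeff-deg≢0 g deg-g≡3 g₃≡0
  ... | inj₂ (_ , deg-h≡3) = coeff-deg≢0 h deg-h≡3 h₃≡0

  apply≡ratio : ∀ z → apply f z ≡ ratio (numAt z) (denAt z)
  apply≡ratio (just x) with eval h x ≟ 0#
  ... | yes _ = refl
  ... | no  _ = refl
  apply≡ratio nothing = at-∞ (deg g) (deg h) refl refl degree-cases
    where
    g₃≡0 : ∀ {d} → deg g ≡ d → d ℕ.< 3 → coeff g 3 ≡ 0#
    g₃≡0 refl d<3 = coeff-deg< g d<3
    h₃≡0 : ∀ {d} → deg h ≡ d → d ℕ.< 3 → coeff h 3 ≡ 0#
    h₃≡0 refl d<3 = coeff-deg< h d<3
    h₃≢0 : deg h ≡ 3 → coeff h 3 ≢ 0#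
    h₃≢0 = coeff-deg≢0 h
    zero≡ratio : coeff g 3 ≡ 0# → coeff h 3 ≢ 0# → just 0# ≡ ratio (coeff g 3) (coeff h 3)
    zero≡ratio g₃≡0 h₃≢0 = sym (trans (ratio-≢0 h₃≢0) (cong just (trans (cong (_* coeff h 3 ⁻¹) g₃≡0) (zeroˡ _))))
    at-∞ : ∀ dg dh → deg g ≡ dg → deg h ≡ dh → (dg ≡ 3 × dh ℕ.< 3) ⊎ (dg ℕ.≤ 3 × dh ≡ 3) →
      (if dg ℕ.<ᵇ dh then just 0# else if dh ℕ.<ᵇ dg then nothing else just (coeff g dg * coeff h dh ⁻¹))
        ≡ ratio (coeff g 3) (coeff h 3)
    at-∞ 3 0 _  eh (inj₁ (refl , dh<3)) = sym (ratio-0 (h₃≡0 eh dh<3))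
    at-∞ 3 1 _  eh (inj₁ (refl , dh<3)) = sym (ratio-0 (h₃≡0 eh dh<3))
    at-∞ 3 2 _  eh (inj₁ (refl , dh<3)) = sym (ratio-0 (h₃≡0 eh dh<3))
    at-∞ 0 3 eg eh (inj₂ (_ , refl))    = zero≡ratio (g₃≡0 eg ℕ.z<s) (h₃≢0 eh)
    at-∞ 1 3 eg eh (inj₂ (_ , refl))    = zero≡ratio (g₃≡0 eg (ℕ.s<s ℕ.z<s)) (h₃≢0 eh)
    at-∞ 2 3 eg eh (inj₂ (_ , refl))    = zero≡ratio (g₃≡0 eg (ℕ.s<s (ℕ.s<s ℕ.z<s))) (h₃≢0 eh)
    at-∞ 3 3 _  eh (inj₂ (_ , refl))    = sym (ratio-≢0 (h₃≢0 eh))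
    at-∞ 3 (suc (suc (suc _))) _ _ (inj₁ (_ , ℕ.s≤s (ℕ.s≤s (ℕ.s≤s ()))))
    at-∞ (suc (suc (suc (suc _)))) _ _ _ (inj₂ (ℕ.s≤s (ℕ.s≤s (ℕ.s≤s ())) , _))

  eval-fibrePoly : ∀ α x → eval (fibrePoly α) x ≡ pointForm α (eval g x) (eval h x)
  eval-fibrePoly (just α) x = begin
    eval (g +ₚ (-ₚ (α ·ₚ h))) x          ≡⟨ eval-+ₚ g (-ₚ (α ·ₚ h)) x ⟩
    eval g x + eval (-ₚ (α ·ₚ h)) x      ≡⟨ cong (eval g x +_) (trans (eval-negₚ (α ·ₚ h) x) (cong (-_) (eval-·ₚ α h x))) ⟩
    eval g x - α * eval h x              ∎
    where open ≡-Reasoning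
  eval-fibrePoly nothing  x = refl

  Root-fibre⇔IsRatio : ∀ α z → Root (fibre α) z ⇔ IsRatio α (numAt z) (denAt z)
  Root-fibre⇔IsRatio α (just x) = mk⇔ (trans (sym value≡)) (trans value≡)
    where
    value≡ : value (fibre α) x ≡ pointForm α (eval g x) (eval h x)
    value≡ = trans (sym (taylor₀-toPoly (fibre α) x)) (trans (sym (eval-cong x (fibrePoly≋ α))) (eval-fibrePoly α x))
  Root-fibre⇔IsRatio (just α) nothing = ⇔.refl
  Root-fibre⇔IsRatio nothing  nothing = ⇔.refl

  apply≡⇔Root-fibre : ∀ α z → apply f z ≡ α ⇔ Root (fibre α) z
  apply≡⇔Root-fibre α z =
    ⇔.trans (mk⇔ (trans (sym (apply≡ratio z))) (trans (apply≡ratio z)))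
    (⇔.trans (⇔.sym (IsRatio⇔ratio≡ (numAt-denAt-≢0 z))) (⇔.sym (Root-fibre⇔IsRatio α z)))

  polePoly : P1 → Poly
  polePoly (just _) = h
  polePoly nothing  = g

  RamIndex-just⇔ : ∀ x n → let β = apply f (just x) in RamIndex f (just x) n ⇔ ValEq x (fibrePoly β) (polePoly β) n
  RamIndex-just⇔ x n with apply f (just x)
  ... | just _  = ⇔.refl
  ... | nothing = ⇔.refl

  revFibrePoly revPolePoly : ℕ → P1 → Poly
  revFibrePoly D (just α) = rev D g +ₚ (-ₚ (α ·ₚ rev D h))
  revFibrePoly D nothing  = rev D h
  revPolePoly  D (just _) = rev D h
  revPolePoly  D nothing  = rev D g

  RamIndex-∞⇔ : ∀ n → let β = apply f nothing in
    RamIndex f nothing n ⇔ ValEq 0# (revFibrePoly (degR f) β) (revPolePoly (degR f) β) n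
  RamIndex-∞⇔ n with apply f nothing
  ... | just _  = ⇔.refl
  ... | nothing = ⇔.refl

  poleValue-apply≢0 : ∀ z → poleValue (apply f z) (numAt z) (denAt z) ≢ 0#
  poleValue-apply≢0 z = subst (λ β → poleValue β (numAt z) (denAt z) ≢ 0#) (sym (apply≡ratio z))
                              (poleValue≢0 (numAt-denAt-≢0 z))

  eval-polePoly : ∀ β x → eval (polePoly β) x ≡ poleValue β (eval g x) (eval h x)
  eval-polePoly (just _) x = refl
  eval-polePoly nothing  x = refl

  eval-rev₃-0 : ∀ p → eval (rev 3 p) 0# ≡ coeff p 3
  eval-rev₃-0 p = trans (taylor₀-toPoly (reverse (cubicOf p)) 0#) (value-reverse-0 (cubicOf p))

  eval-revPolePoly : ∀ β → eval (revPolePoly 3 β) 0# ≡ poleValue β (coeff g 3) (coeff h 3)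
  eval-revPolePoly (just _) = eval-rev₃-0 h
  eval-revPolePoly nothing  = eval-rev₃-0 g

  revFibrePoly≡ : ∀ β → revFibrePoly 3 β ≡ toPoly (reverse (fibre β))
  revFibrePoly≡ (just _) = refl
  revFibrePoly≡ nothing  = refl

  RamIndex₂⇔DoubleRoot : ∀ z → RamIndex f z 2 ⇔ DoubleRoot (fibre (apply f z)) z
  RamIndex₂⇔DoubleRoot (just x) =
    ⇔.trans (RamIndex-just⇔ x 2)
    (⇔.trans (ValEq⇔Ord (fibrePoly β) (polePoly β) pole≢0)
             (Ord₂⇔DoubleRoot x (fibrePoly≋ β)))
    where
    β = apply f (just x)
    pole≢0 : eval (polePoly β) x ≢ 0#
    pole≢0 = subst (_≢ 0#) (sym (eval-polePoly β x)) (poleValue-apply≢0 (just x))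
  RamIndex₂⇔DoubleRoot nothing =
    ⇔.trans (subst (λ D → RamIndex f nothing 2 ⇔ ValEq 0# (revFibrePoly D β) (revPolePoly D β) 2) deg≡3 (RamIndex-∞⇔ 2))
    (⇔.trans (ValEq⇔Ord (revFibrePoly 3 β) (revPolePoly 3 β) pole≢0)
    (⇔.trans (Ord₂⇔DoubleRoot 0# (≋-reflexive (revFibrePoly≡ β)))
             (⇔.sym (DoubleRoot-∞⇔reverse (fibre β)))))
    where
    β = apply f nothing
    pole≢0 : eval (revPolePoly 3 β) 0# ≢ 0#
    pole≢0 = subst (_≢ 0#) (sym (eval-revPolePoly β)) (poleValue-apply≢0 nothing)

  preimage⇔ExactlyTwoRoots : ∀ α x y →
    (x ≢ y × apply f x ≡ α × apply f y ≡ α × (∀ z → apply f z ≡ α → z ≡ x ⊎ z ≡ y))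
      ⇔ ExactlyTwoRoots (fibre α) x y
  preimage⇔ExactlyTwoRoots α x y = mk⇔
    (λ (x≢y , fx≡α , fy≡α , only) → x≢y , to fx≡α , to fy≡α , λ z root → only z (from root))
    (λ (x≢y , root-x , root-y , only) → x≢y , from root-x , from root-y , λ z fz≡α → only z (to fz≡α))
    where
    to : ∀ {z} → apply f z ≡ α → Root (fibre α) z
    to = Equivalence.to (apply≡⇔Root-fibre α _)
    from : ∀ {z} → Root (fibre α) z → apply f z ≡ α
    from = Equivalence.from (apply≡⇔Root-fibre α _)

  ClassII⇒HasRam21 : ClassII f → HasRam21 f
  ClassII⇒HasRam21 (α , x , y , preimage@(_ , fx≡α , fy≡α , _)) =
    [ (λ double-x → x , ramified x fx≡α double-x) , (λ double-y → y , ramified y fy≡α double-y) ]′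
      (exactlyTwoRoots⇒doubleRoot (Equivalence.to (preimage⇔ExactlyTwoRoots α x y) preimage))
    where
    ramified : ∀ z → apply f z ≡ α → DoubleRoot (fibre α) z → RamIndex f z 2
    ramified z refl = Equivalence.from (RamIndex₂⇔DoubleRoot z)

  HasRam21⇒ClassII : HasRam21 f → ClassII f
  HasRam21⇒ClassII (a , ram) =
    let (y , two) = doubleRoot⇒exactlyTwoRoots (Equivalence.to (RamIndex₂⇔DoubleRoot a) ram)
    in apply f a , a , y , Equivalence.from (preimage⇔ExactlyTwoRoots (apply f a) a y) two

lemma6p2 : ∀ {c : Level} (F : FiniteField c) (f : PolyDefs.RatFun F) →
    PolyDefs.degR F f ≡ 3 →
    (PolyDefs.ClassII F f → PolyDefs.HasRam21 F f) ×
    (PolyDefs.HasRam21 F f → PolyDefs.ClassII F f)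
lemma6p2 F f deg≡3 = ClassII⇒HasRam21 , HasRam21⇒ClassII
  where open DegreeThree F f deg≡3
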